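{- Let $G$ be a connected undirected graph and $Z\subseteq V(G)$ with $|Z|\le 4$. Suppose edge capacities $c:E(G)\to\mathbb{R}_{>0}$ are such that no two central cuts have the same capacity, so that there is a unique GH $Z$-tree $T$. Then $T$ occurs as a weak bag minor in $G$, and if $T$ is a path, then $T$ occurs as a bag minor in $G$.
   Context: For $A\subseteq V$, $\delta(A)$ is the set of edges with exactly one end in $A$; it is central if both $G[A]$ and $G[V\setminus A]$ are connected. A minimum $st$-cut is a minimum-capacity $\delta(A)$ with $s\in A$, $t\notin A$. A GH $Z$-tree is a partition $\{B(v):v\in Z\}$ of $V(G)$ with $z\in B(z)$ (the bags), together with a tree $T$ on vertex set $Z$ with capacities $c'$ on $E(T)$, such that for every edge $st\in E(T)$, if $S$ is the vertex set of the component of $T-st$ containing $s$, then $\delta(\bigcup_{x\in S}B(x))$ is a minimum $st$-cut in $G$ of capacity $c'(st)$. $T$ occurs as a bag minor in $G$ if (i) each $G[B(v)]$ is connected and (ii) for each $st\in E(T)$ there is an edge of $G$ between $B(s)$ and $B(t)$. $T$ occurs as a weak bag minor if it occurs as a bag minor after deleting some non-terminal vertices (from $G$ and from the bags). -}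

module Defs where

open import Level using (0ℓ)
open import Data.Nat using (ℕ; _<ᵇ_; _≤_)
open import Data.Bool using (Bool; true; false; _∧_; _∨_; not; _xor_)
open import Data.Fin using (Fin; toℕ; _≟_)
open import Data.List using (List; []; _∷_; length; concatMap; map; allFin; filterᵇ; foldr; _∷ʳ_)
open import Data.List.Relation.Unary.Unique.Propositional using (Unique)
open import Data.List.Relation.Unary.Linked using (Linked)
open import Data.Product using (Σ; ∃; ∃-syntax; _×_; _,_; proj₁; proj₂)
open import Data.Sum using (_⊎_)
open import Function using (_∘_; const; _⇔_)
open import Function.Definitions using (Injective)
open import Relation.Binary.PropositionalEquality using (_≡_; _≢_)
open import Relation.Binary using (Rel; IsStrictTotalOrder)
open import Relation.Nullary using (¬_)
open import Relation.Nullary.Decidable using (⌊_⌋)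
open import Algebra.Core using (Op₁; Op₂)
open import Algebra.Structures using (IsCommutativeRing)

-- The real numbers, axiomatised as a complete ordered field.
-- (agda-stdlib has no reals; the theorem is quantified over every model
-- of these axioms, i.e. over ℝ.)  Only 0, + and < are used below.

record Reals : Set₁ where
  infixl 6 _+_
  infixl 7 _*_
  infix 4 _<_
  field
    Carrier : Set
    0ℝ 1ℝ : Carrier
    _+_ _*_ : Op₂ Carrier
    -_ : Op₁ Carrier
    _<_ : Rel Carrier 0ℓ
    isCommutativeRing : IsCommutativeRing _≡_ _+_ _*_ -_ 0ℝ 1ℝ
    0≢1 : 0ℝ ≢ 1ℝ
    inverse : ∀ x → x ≢ 0ℝ → ∃ λ y → x * y ≡ 1ℝ
    isStrictTotalOrder : IsStrictTotalOrder _≡_ _<_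
    +-mono-< : ∀ x y z → x < y → x + z < y + z
    *-pos : ∀ x y → 0ℝ < x → 0ℝ < y → 0ℝ < x * y
    complete : (P : Carrier → Set) → ∃ P →
               (∃ λ b → ∀ x → P x → (x < b ⊎ x ≡ b)) →
               ∃ λ s → (∀ x → P x → (x < s ⊎ x ≡ s)) ×
                       (∀ b → (∀ x → P x → (x < b ⊎ x ≡ b)) → (s < b ⊎ s ≡ b))

record Graph (n : ℕ) : Set where
  field
    adj : Fin n → Fin n → Bool
    adj-sym : ∀ u v → adj u v ≡ adj v u
    adj-irr : ∀ u → adj u u ≡ false

open Graph public

VSet : ℕ → Set
VSet n = Fin n → Bool

data Walk {n : ℕ} (a : Fin n → Fin n → Bool) (P : VSet n) : Fin n → Fin n → Set where
  here : ∀ {u} → P u ≡ true → Walk a P u u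
  step : ∀ {u v w} → P u ≡ true → a u v ≡ true → Walk a P v w → Walk a P u w

InducedConnected : {n : ℕ} → (Fin n → Fin n → Bool) → VSet n → Set
InducedConnected a P = ∀ u v → P u ≡ true → P v ≡ true → Walk a P u v

Connected : {n : ℕ} → (Fin n → Fin n → Bool) → Set
Connected a = InducedConnected a (const true)

HasCycle : {n : ℕ} → (Fin n → Fin n → Bool) → Set
HasCycle a = ∃ λ x → ∃ λ xs → 2 ≤ length xs × Unique (x ∷ xs) ×
             Linked (λ u v → a u v ≡ true) ((x ∷ xs) ∷ʳ x)

record Tree (k : ℕ) : Set where
  field
    tgraph : Graph k
    tconnected : Connected (adj tgraph)
    tacyclic : ¬ HasCycle (adj tgraph)

open Tree public

IsPathTree : {k : ℕ} → Tree k → Set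
IsPathTree {k} T = Σ (Fin k → Fin k) λ π → Injective _≡_ _≡_ π ×
  (∀ i j → (adj (tgraph T) (π i) (π j) ≡ true) ⇔
           ((toℕ i Data.Nat.+ 1 ≡ toℕ j) ⊎ (toℕ j Data.Nat.+ 1 ≡ toℕ i)))

module _ (ℝ : Reals) where
  open Reals ℝ

  _≤ℝ_ : Carrier → Carrier → Set
  x ≤ℝ y = x < y ⊎ x ≡ y

  pairs : (n : ℕ) → List (Fin n × Fin n)
  pairs n = filterᵇ (λ p → toℕ (proj₁ p) <ᵇ toℕ (proj₂ p))
                    (concatMap (λ u → map (u ,_) (allFin n)) (allFin n))

  cutCap : {n : ℕ} → Graph n → (Fin n → Fin n → Carrier) → VSet n → Carrier
  cutCap {n} G c A =
    foldr (λ p acc → c (proj₁ p) (proj₂ p) + acc) 0ℝ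
      (filterᵇ (λ p → adj G (proj₁ p) (proj₂ p) ∧ (A (proj₁ p) xor A (proj₂ p)))
               (pairs n))

  PositiveCapacity : {n : ℕ} → Graph n → (Fin n → Fin n → Carrier) → Set
  PositiveCapacity G c = ∀ u v → adj G u v ≡ true → (0ℝ < c u v) × (c u v ≡ c v u)

  Central : {n : ℕ} → Graph n → VSet n → Set
  Central G A = InducedConnected (adj G) A × InducedConnected (adj G) (not ∘ A)

  SameCut : {n : ℕ} → Graph n → VSet n → VSet n → Set
  SameCut G A B = ∀ u v → adj G u v ≡ true → (A u xor A v) ≡ (B u xor B v)

  DistinctCentralCapacities : {n : ℕ} → Graph n → (Fin n → Fin n → Carrier) → Set
  DistinctCentralCapacities G c = ∀ A B → Central G A → Central G B →
    cutCap G c A ≡ cutCap G c B → SameCut G A B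

  IsMinCut : {n : ℕ} → Graph n → (Fin n → Fin n → Carrier) → Fin n → Fin n → VSet n → Set
  IsMinCut G c s t A = A s ≡ true × A t ≡ false ×
    (∀ B → B s ≡ true → B t ≡ false → cutCap G c A ≤ℝ cutCap G c B)

  removeEdge : {k : ℕ} → (Fin k → Fin k → Bool) → Fin k → Fin k → Fin k → Fin k → Bool
  removeEdge a s t x y = a x y ∧ not ((⌊ x ≟ s ⌋ ∧ ⌊ y ≟ t ⌋) ∨ (⌊ x ≟ t ⌋ ∧ ⌊ y ≟ s ⌋))

  -- A GH Z-tree, for Z = image of the injection z : Fin k → Fin n.
  -- The bags are B(i) = { v | bag v ≡ i }.
  record GHTree {n k : ℕ} (G : Graph n) (c : Fin n → Fin n → Carrier)
                (z : Fin k → Fin n) : Set where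
    field
      bag : Fin n → Fin k
      bag-z : ∀ i → bag (z i) ≡ i
      tree : Tree k
      cap' : Fin k → Fin k → Carrier
      gh : ∀ s t → adj (tgraph tree) s t ≡ true →
           ∃ λ (A : VSet n) →
             (∀ v → (A v ≡ true) ⇔ Walk (removeEdge (adj (tgraph tree)) s t) (const true) s (bag v)) ×
             IsMinCut G c (z s) (z t) A × (cutCap G c A ≡ cap' s t)

  open GHTree public

  BagMinorAfterDeleting : {n k : ℕ} {G : Graph n} {c : Fin n → Fin n → Carrier}
    {z : Fin k → Fin n} → GHTree G c z → VSet n → Set
  BagMinorAfterDeleting {G = G} H D =
    (∀ i → InducedConnected (adj G) (λ v → ⌊ bag H v ≟ i ⌋ ∧ not (D v))) ×
    (∀ s t → adj (tgraph (tree H)) s t ≡ true →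
      ∃ λ u → ∃ λ v → bag H u ≡ s × bag H v ≡ t × D u ≡ false × D v ≡ false × adj G u v ≡ true)

  BagMinor : {n k : ℕ} {G : Graph n} {c : Fin n → Fin n → Carrier}
    {z : Fin k → Fin n} → GHTree G c z → Set
  BagMinor H = BagMinorAfterDeleting H (const false)

  WeakBagMinor : {n k : ℕ} {G : Graph n} {c : Fin n → Fin n → Carrier}
    {z : Fin k → Fin n} → GHTree G c z → Set
  WeakBagMinor {z = z} H = ∃ λ (D : VSet _) → (∀ i → D (z i) ≡ false) × BagMinorAfterDeleting H D

-- The cut of every edge of the GH tree is a minimum cut, hence central, so by
-- the uniqueness hypothesis it is the only minimum cut of its capacity.  All
-- bag-minor properties follow from one exchange argument.  To show that some
-- part of G is empty (the part of a bag not reachable from its terminal), or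
-- that G has an edge between two bags, assume the contrary and form vertex sets
-- X₁ ∋ s, X₂ from the pieces so that every edge is cut by X₁ and X₂ together at
-- most as often as by two tree cuts Y₁, Y₂, where Y₁ is a minimum st-cut with
-- t ∉ X₁ and c(δ(Y₂)) ≤ c(δ(X₂)).  Then c(δ(X₁)) ≤ c(δ(Y₁)), so X₁ is a minimum
-- st-cut of the same capacity and hence X₁ = Y₁, a contradiction.  A tree on at
-- most four vertices is a path or a star, and for these shapes the counting
-- conditions are finite checks.  Only the centre bag of a star can be
-- disconnected; deleting its part not reachable from the terminal leaves a bag
-- minor.

module Submission where

open import Defs
open import Data.Bool using (Bool; true; false; _∧_; _∨_; not; _xor_; if_then_else_)
open import Data.Bool.ListAction using (any)
open import Data.Bool.Properties as Bool
  using (T-≡; ∧-conicalˡ; ∧-conicalʳ; ∧-zeroʳ; ∧-identityʳ; xor-annihilates-not)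
open import Data.Empty using (⊥; ⊥-elim)
open import Data.Fin using (Fin; zero; suc; toℕ; _≟_)
open import Data.Fin.Patterns using (0F; 1F; 2F; 3F; 4F)
import Data.Fin.Properties as Fin
open import Data.Fin.Permutation using (Permutation; permutation; _⟨$⟩ʳ_; _⟨$⟩ˡ_; inverseˡ; inverseʳ; transpose)
open import Data.List using (List; []; _∷_; filterᵇ; foldr; map; concatMap; allFin; length; _∷ʳ_)
open import Data.List.Membership.Propositional using (_∈_)
open import Data.List.Membership.Propositional.Properties using (∈-map⁺; ∈-concatMap⁺; ∈-filter⁺; ∈-allFin)
import Data.List.Membership.DecPropositional as DecMembership
open import Data.List.Relation.Unary.All as All using (All)
open import Data.List.Relation.Unary.Any as Any using (here; there)
import Data.List.Relation.Unary.Linked as Linked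
import Data.List.Relation.Unary.Unique.DecPropositional as Unique
open import Data.Nat as ℕ using (ℕ; zero; suc; z≤n; s≤s; _<ᵇ_)
import Data.Nat.Properties as ℕ
open import Data.Product using (∃; _×_; _,_; proj₁; proj₂)
import Data.Product.Properties as Product
open import Data.Sum using (_⊎_; inj₁; inj₂)
open import Data.Unit using (tt)
open import Data.Vec using (Vec; lookup; []; _∷_)
open import Function using (_∘_; id; const)
open import Function.Bundles using (Equivalence)
open import Function.Definitions using (Injective)
open import Relation.Binary using (IsStrictTotalOrder; tri<; tri≈; tri>)
open import Relation.Binary.PropositionalEquality
open import Relation.Nullary using (Dec; yes; no; ¬_)
open import Relation.Nullary.Decidable
  using (⌊_⌋; True; toWitness; _×-dec_; _→-dec_; ¬?)
open import Algebra.Structures using (IsCommutativeRing)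

≟⇒≡ : ∀ {m} {i j : Fin m} → ⌊ i ≟ j ⌋ ≡ true → i ≡ j
≟⇒≡ h = toWitness (Equivalence.from T-≡ h)

≟-refl : ∀ {m} (i : Fin m) → ⌊ i ≟ i ⌋ ≡ true
≟-refl i = cong ⌊_⌋ (≡-≟-identity _≟_ refl)

≟-≢ : ∀ {m} {i j : Fin m} → i ≢ j → ⌊ i ≟ j ⌋ ≡ false
≟-≢ i≢j = cong ⌊_⌋ (≢-≟-identity _≟_ i≢j)

∧-true⁺ : ∀ {x y} → x ≡ true → y ≡ true → x ∧ y ≡ true
∧-true⁺ refl refl = refl

∨-trueˡ : ∀ {x} y → x ≡ true → x ∨ y ≡ true
∨-trueˡ y refl = refl

∨-trueʳ : ∀ x {y} → y ≡ true → x ∨ y ≡ true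
∨-trueʳ true _ = refl
∨-trueʳ false h = h

true≢false : true ≢ false
true≢false ()

∖-⊆-empty : ∀ {a r} → (a ≡ true → r ≡ true) → a ∧ not r ≡ false
∖-⊆-empty {true} {true} _ = refl
∖-⊆-empty {true} {false} a⊆r = sym (a⊆r refl)
∖-⊆-empty {false} _ = refl

∖-∖-⊆ : ∀ {a r} → (r ≡ true → a ≡ true) → a ∧ not (a ∧ not r) ≡ r
∖-∖-⊆ {true} {true} _ = refl
∖-∖-⊆ {true} {false} _ = refl
∖-∖-⊆ {false} {true} r⊆a = r⊆a refl
∖-∖-⊆ {false} {false} _ = refl

∖-disjoint : ∀ {a b} r → (a ≡ true → b ≡ false) → a ∧ not (b ∧ not r) ≡ a
∖-disjoint {true} {true} _ disjoint = ⊥-elim (true≢false (disjoint refl))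
∖-disjoint {true} {false} _ _ = refl
∖-disjoint {false} _ _ = refl

≡-from-true⇔true : ∀ {x y} → (x ≡ true → y ≡ true) → (y ≡ true → x ≡ true) → x ≡ y
≡-from-true⇔true {true} {true} _ _ = refl
≡-from-true⇔true {true} {false} f _ = sym (f refl)
≡-from-true⇔true {false} {true} _ g = g refl
≡-from-true⇔true {false} {false} _ _ = refl

indicator : Bool → ℕ
indicator true = 1
indicator false = 0

crossings : {A : Set} → (A → Bool) → (A → Bool) → A → A → ℕ
crossings X Y u v = indicator (X u xor X v) ℕ.+ indicator (Y u xor Y v)

⟦_⟧ : ∀ {r} → List (Fin r) → Fin r → Bool
⟦ is ⟧ j = any (λ i → ⌊ j ≟ i ⌋) is

⟦⟧-single : ∀ {r} {j : Fin r} i → ⟦ j ∷ [] ⟧ i ≡ ⌊ i ≟ j ⌋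
⟦⟧-single {j = j} i = Bool.∨-identityʳ ⌊ i ≟ j ⌋

⟦⟧-single⇒≡ : ∀ {r} {i j : Fin r} → ⟦ j ∷ [] ⟧ i ≡ true → i ≡ j
⟦⟧-single⇒≡ {i = i} h = ≟⇒≡ (trans (sym (⟦⟧-single i)) h)

Avoids : ∀ {r} → List (Fin r × Fin r) → Fin r → Fin r → Set
Avoids ps i j = ¬ (i , j) ∈ ps × ¬ (j , i) ∈ ps

CrossingsDominated : ∀ {r} (X₁ X₂ Y₁ Y₂ : Fin r → Bool) → List (Fin r × Fin r) → Set
CrossingsDominated X₁ X₂ Y₁ Y₂ ps = ∀ i j → Avoids ps i j → crossings X₁ X₂ i j ℕ.≤ crossings Y₁ Y₂ i j

crossingsDominated? : ∀ {r} (X₁ X₂ Y₁ Y₂ : Fin r → Bool) ps → Dec (CrossingsDominated X₁ X₂ Y₁ Y₂ ps)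
crossingsDominated? X₁ X₂ Y₁ Y₂ ps = Fin.all? λ i → Fin.all? λ j →
  (¬? ((i , j) ∈? ps) ×-dec ¬? ((j , i) ∈? ps)) →-dec (crossings X₁ X₂ i j ℕ.≤? crossings Y₁ Y₂ i j)
  where open DecMembership (Product.≡-dec Fin._≟_ Fin._≟_)

indicator-mono : ∀ {x y} → (x ≡ true → y ≡ true) → indicator x ℕ.≤ indicator y
indicator-mono {false} _ = z≤n
indicator-mono {true} h rewrite h refl = s≤s z≤n

-- Walks and reachability

module _ {n : ℕ} where

  walk-source : ∀ {a P u w} → Walk {n} a P u w → P u ≡ true
  walk-source (here p) = p
  walk-source (step p _ _) = p

  walk-weaken : ∀ {a P Q u w} → (∀ x → P x ≡ true → Q x ≡ true) → Walk {n} a P u w → Walk a Q u w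
  walk-weaken f (here p) = here (f _ p)
  walk-weaken f (step p e r) = step (f _ p) e (walk-weaken f r)

  walk-mapEdges : ∀ {a b P u w} → (∀ x y → a x y ≡ true → b x y ≡ true) → Walk {n} a P u w → Walk b P u w
  walk-mapEdges f (here p) = here p
  walk-mapEdges f (step p e r) = step p (f _ _ e) (walk-mapEdges f r)

  walk-snoc : ∀ {a P u v w} → Walk {n} a P u v → a v w ≡ true → P w ≡ true → Walk a P u w
  walk-snoc (here p) e q = step p e (here q)
  walk-snoc (step p e r) e′ q = step p e (walk-snoc r e′ q)

  walk-++ : ∀ {a P u v w} → Walk {n} a P u v → Walk a P v w → Walk a P u w
  walk-++ (here _) r = r
  walk-++ (step p e r) r′ = step p e (walk-++ r r′)

  walk-reverse : ∀ {a P u v} → (∀ x y → a x y ≡ a y x) → Walk {n} a P u v → Walk a P v u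
  walk-reverse sym-a (here p) = here p
  walk-reverse sym-a (step p e r) = walk-snoc (walk-reverse sym-a r) (trans (sym-a _ _) e) p

  InducedConnected-from : ∀ {a P} s → (∀ x y → a x y ≡ a y x) →
    (∀ v → P v ≡ true → Walk {n} a P s v) → InducedConnected a P
  InducedConnected-from s sym-a walks u v pu pv =
    walk-++ (walk-reverse sym-a (walks u pu)) (walks v pv)

  InducedConnected-resp : ∀ {a P Q} → (∀ x → P x ≡ Q x) → InducedConnected {n} a P → InducedConnected a Q
  InducedConnected-resp P≗Q conn u v qu qv =
    walk-weaken (λ x p → trans (sym (P≗Q x)) p) (conn u v (trans (P≗Q u) qu) (trans (P≗Q v) qv))

anyᶠ : ∀ {m} → (Fin m → Bool) → Bool
anyᶠ {zero} f = false
anyᶠ {suc m} f = f zero ∨ anyᶠ (f ∘ suc)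

anyᶠ-intro : ∀ {m} (f : Fin m → Bool) i → f i ≡ true → anyᶠ f ≡ true
anyᶠ-intro f zero e = ∨-trueˡ _ e
anyᶠ-intro f (suc i) e = ∨-trueʳ (f zero) (anyᶠ-intro (f ∘ suc) i e)

anyᶠ-elim : ∀ {m} (f : Fin m → Bool) → anyᶠ f ≡ true → ∃ λ i → f i ≡ true
anyᶠ-elim {suc m} f e with f zero in eq
... | true = zero , eq
... | false = let (i , q) = anyᶠ-elim (f ∘ suc) e in suc i , q

anyᶠ-cong : ∀ {m} {f g : Fin m → Bool} → (∀ i → f i ≡ g i) → anyᶠ f ≡ anyᶠ g
anyᶠ-cong {zero} e = refl
anyᶠ-cong {suc m} e = cong₂ _∨_ (e zero) (anyᶠ-cong (e ∘ suc))

count : ∀ {m} → (Fin m → Bool) → ℕ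
count {zero} f = 0
count {suc m} f = indicator (f zero) ℕ.+ count (f ∘ suc)

count-≤ : ∀ {m} (f : Fin m → Bool) → count f ℕ.≤ m
count-≤ {zero} f = z≤n
count-≤ {suc m} f with f zero
... | true = s≤s (count-≤ (f ∘ suc))
... | false = ℕ.m≤n⇒m≤1+n (count-≤ (f ∘ suc))

count-mono : ∀ {m} {f g : Fin m → Bool} → (∀ i → f i ≡ true → g i ≡ true) → count f ℕ.≤ count g
count-mono {zero} h = z≤n
count-mono {suc m} h = ℕ.+-mono-≤ (indicator-mono (h zero)) (count-mono (h ∘ suc))

count-strict : ∀ {m} {f g : Fin m → Bool} → (∀ i → f i ≡ true → g i ≡ true) →
  ∀ i → f i ≡ false → g i ≡ true → count f ℕ.< count g
count-strict h zero fi gi rewrite fi | gi = s≤s (count-mono (h ∘ suc))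
count-strict h (suc i) fi gi =
  ℕ.+-mono-≤-< (indicator-mono (h zero)) (count-strict (h ∘ suc) i fi gi)

bool-⊆-cases : ∀ x y → (x ≡ true → y ≡ true) → y ≡ x ⊎ (x ≡ false × y ≡ true)
bool-⊆-cases false false _ = inj₁ refl
bool-⊆-cases false true _ = inj₂ (refl , refl)
bool-⊆-cases true true _ = inj₁ refl
bool-⊆-cases true false h = ⊥-elim (true≢false (sym (h refl)))

⊆-≗-or-grows : ∀ {m} (f g : Fin m → Bool) → (∀ i → f i ≡ true → g i ≡ true) →
  (∀ i → g i ≡ f i) ⊎ (∃ λ i → f i ≡ false × g i ≡ true)
⊆-≗-or-grows {zero} f g _ = inj₁ (λ ())
⊆-≗-or-grows {suc m} f g f⊆g
  with bool-⊆-cases (f zero) (g zero) (f⊆g zero) | ⊆-≗-or-grows (f ∘ suc) (g ∘ suc) (f⊆g ∘ suc)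
... | inj₂ (p , q) | _ = inj₂ (zero , p , q)
... | inj₁ e₀ | inj₁ h = inj₁ λ { zero → e₀ ; (suc i) → h i }
... | inj₁ _ | inj₂ (i , p , q) = inj₂ (suc i , p , q)

-- reach is the (n+1)-st breadth-first layer around s; the layers grow until
-- they stabilise, and a strictly growing chain of subsets of Fin n has length
-- at most n.
module Reachability {n : ℕ} (a : Fin n → Fin n → Bool) (P : VSet n) (s : Fin n) where

  layer : ℕ → VSet n
  layer zero v = ⌊ v ≟ s ⌋ ∧ P v
  layer (suc j) v = layer j v ∨ (P v ∧ anyᶠ (λ u → layer j u ∧ a u v))

  private
    layer-⊆ : ∀ j v → layer j v ≡ true → P v ≡ true
    layer-⊆ zero v e = ∧-conicalʳ ⌊ v ≟ s ⌋ _ e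
    layer-⊆ (suc j) v e with layer j v in q
    ... | true = layer-⊆ j v q
    ... | false = ∧-conicalˡ (P v) _ e

    layer-mono : ∀ j v → layer j v ≡ true → layer (suc j) v ≡ true
    layer-mono j v e = ∨-trueˡ _ e

    layer-source : ∀ j → P s ≡ true → layer j s ≡ true
    layer-source zero p = ∧-true⁺ (≟-refl s) p
    layer-source (suc j) p = layer-mono j s (layer-source j p)

    layer-walk : ∀ j v → layer j v ≡ true → Walk a (layer j) s v
    layer-walk zero v e = subst (λ x → Walk a (layer zero) x v) (≟⇒≡ (∧-conicalˡ _ (P v) e)) (here e)
    layer-walk (suc j) v e with layer j v in q
    ... | true = walk-weaken (layer-mono j) (layer-walk j v q)
    ... | false =
      let (u , h) = anyᶠ-elim (λ u → layer j u ∧ a u v) (∧-conicalʳ (P v) _ e)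
      in walk-snoc (walk-weaken (layer-mono j) (layer-walk j u (∧-conicalˡ _ _ h)))
                   (∧-conicalʳ _ _ h) (∨-trueʳ (layer j v) e)

    Stable : ℕ → Set
    Stable j = ∀ v → layer (suc j) v ≡ layer j v

    stable-suc : ∀ j → Stable j → Stable (suc j)
    stable-suc j st v =
      cong₂ (λ x y → x ∨ (P v ∧ y)) (st v) (anyᶠ-cong (λ u → cong (_∧ a u v) (st u)))

    stable-or-grows : ∀ j → Stable j ⊎ count (layer j) ℕ.< count (layer (suc j))
    stable-or-grows j with ⊆-≗-or-grows (layer j) (layer (suc j)) (layer-mono j)
    ... | inj₁ st = inj₁ st
    ... | inj₂ (i , p , q) = inj₂ (count-strict (layer-mono j) i p q)

    stable-or-large : ∀ j → Stable j ⊎ j ℕ.≤ count (layer j)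
    stable-or-large zero = inj₂ z≤n
    stable-or-large (suc j) with stable-or-large j | stable-or-grows j
    ... | inj₁ st | _ = inj₁ (stable-suc j st)
    ... | inj₂ _ | inj₁ st = inj₁ (stable-suc j st)
    ... | inj₂ le | inj₂ lt = inj₂ (ℕ.≤-trans (s≤s le) lt)

    stable : Stable (suc n)
    stable with stable-or-large (suc n)
    ... | inj₁ st = st
    ... | inj₂ le = ⊥-elim (ℕ.<⇒≱ (s≤s (count-≤ (layer (suc n)))) le)

  reach : VSet n
  reach = layer (suc n)

  reach-⊆ : ∀ v → reach v ≡ true → P v ≡ true
  reach-⊆ = layer-⊆ (suc n)

  reach-walk : ∀ v → reach v ≡ true → Walk a reach s v
  reach-walk = layer-walk (suc n)

  reach-source : P s ≡ true → reach s ≡ true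
  reach-source = layer-source (suc n)

  reach-closed : ∀ u v → reach u ≡ true → P v ≡ true → a u v ≡ true → reach v ≡ true
  reach-closed u v ru pv e = trans (sym (stable v))
    (∨-trueʳ (reach v) (∧-true⁺ pv (anyᶠ-intro (λ u → reach u ∧ a u v) u (∧-true⁺ ru e))))

  reach-complete : ∀ {u w} → Walk a P u w → reach u ≡ true → reach w ≡ true
  reach-complete (here _) r = r
  reach-complete (step _ e rest) r = reach-complete rest (reach-closed _ _ r (walk-source rest) e)

-- Cut capacities

module OrderedAddition (ℝ : Reals) where
  open Reals ℝ
  open IsCommutativeRing isCommutativeRing using (+-comm)
  open IsStrictTotalOrder isStrictTotalOrder using (irrefl) renaming (trans to <-trans)

  infix 4 _≤_
  _≤_ : Carrier → Carrier → Set
  _≤_ = _≤ℝ_ ℝ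

  <-irrefl : ∀ {x} → ¬ x < x
  <-irrefl = irrefl refl

  ≤-refl : ∀ {x} → x ≤ x
  ≤-refl = inj₂ refl

  ≤-trans : ∀ {x y z} → x ≤ y → y ≤ z → x ≤ z
  ≤-trans (inj₁ x<y) (inj₁ y<z) = inj₁ (<-trans x<y y<z)
  ≤-trans (inj₁ x<y) (inj₂ refl) = inj₁ x<y
  ≤-trans (inj₂ refl) y≤z = y≤z

  <-≤-trans : ∀ {x y z} → x < y → y ≤ z → x < z
  <-≤-trans x<y (inj₁ y<z) = <-trans x<y y<z
  <-≤-trans x<y (inj₂ refl) = x<y

  +-monoʳ-< : ∀ {x y} z → x < y → z + x < z + y
  +-monoʳ-< {x} {y} z x<y = subst₂ _<_ (+-comm x z) (+-comm y z) (+-mono-< x y z x<y)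

  +-monoˡ-≤ : ∀ {x y} z → x ≤ y → x + z ≤ y + z
  +-monoˡ-≤ z (inj₁ x<y) = inj₁ (+-mono-< _ _ z x<y)
  +-monoˡ-≤ z (inj₂ refl) = ≤-refl

  +-monoʳ-≤ : ∀ {x y} z → x ≤ y → z + x ≤ z + y
  +-monoʳ-≤ z (inj₁ x<y) = inj₁ (+-monoʳ-< z x<y)
  +-monoʳ-≤ z (inj₂ refl) = ≤-refl

  +-mono-≤ : ∀ {x y u v} → x ≤ y → u ≤ v → x + u ≤ y + v
  +-mono-≤ {y = y} {u} x≤y u≤v = ≤-trans (+-monoˡ-≤ u x≤y) (+-monoʳ-≤ y u≤v)

  +-mono-<-≤ : ∀ {x y u v} → x < y → u ≤ v → x + u < y + v
  +-mono-<-≤ {x} {y} {u} x<y u≤v = <-≤-trans (+-mono-< x y u x<y) (+-monoʳ-≤ y u≤v)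

  +-mono-≤-< : ∀ {x y u v} → x ≤ y → u < v → x + u < y + v
  +-mono-≤-< {x} {y} {u} {v} x≤y u<v =
    subst₂ _<_ (+-comm u x) (+-comm v y) (+-mono-<-≤ u<v x≤y)

  +-squeezeˡ : ∀ {x₁ x₂ y₁ y₂} → y₁ ≤ x₁ → y₂ ≤ x₂ → x₁ + x₂ ≤ y₁ + y₂ → x₁ ≡ y₁
  +-squeezeˡ (inj₂ y₁≡x₁) _ _ = sym y₁≡x₁
  +-squeezeˡ (inj₁ y₁<x₁) y₂≤x₂ x≤y = ⊥-elim (<-irrefl (<-≤-trans (+-mono-<-≤ y₁<x₁ y₂≤x₂) x≤y))

module CutCapacity (ℝ : Reals) {n : ℕ} (G : Graph n) (c : Fin n → Fin n → Reals.Carrier ℝ)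
                   (pos : PositiveCapacity ℝ G c) where
  open Reals ℝ
  open OrderedAddition ℝ
  open IsCommutativeRing isCommutativeRing using (+-comm; +-assoc; +-identityˡ; +-identityʳ)

  cap : VSet n → Carrier
  cap = cutCap ℝ G c

  sumOver : {A : Set} → (A → Carrier) → List A → Carrier
  sumOver φ = foldr (λ p acc → φ p + acc) 0ℝ

  sumOver-cong : {A : Set} {φ ψ : A → Carrier} → (∀ p → φ p ≡ ψ p) → ∀ xs → sumOver φ xs ≡ sumOver ψ xs
  sumOver-cong e [] = refl
  sumOver-cong e (x ∷ xs) = cong₂ _+_ (e x) (sumOver-cong e xs)

  sumOver-mono : {A : Set} {φ ψ : A → Carrier} → (∀ p → φ p ≤ ψ p) → ∀ xs → sumOver φ xs ≤ sumOver ψ xs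
  sumOver-mono e [] = ≤-refl
  sumOver-mono e (x ∷ xs) = +-mono-≤ (e x) (sumOver-mono e xs)

  sumOver-strict : {A : Set} {φ ψ : A → Carrier} → (∀ p → φ p ≤ ψ p) →
    ∀ {p} xs → p ∈ xs → φ p < ψ p → sumOver φ xs < sumOver ψ xs
  sumOver-strict e (x ∷ xs) (here refl) φp<ψp = +-mono-<-≤ φp<ψp (sumOver-mono e xs)
  sumOver-strict e (x ∷ xs) (there p∈xs) φp<ψp = +-mono-≤-< (e x) (sumOver-strict e xs p∈xs φp<ψp)

  sumOver-0 : {A : Set} (xs : List A) → sumOver (λ _ → 0ℝ) xs ≡ 0ℝ
  sumOver-0 [] = refl
  sumOver-0 (x ∷ xs) = trans (cong (0ℝ +_) (sumOver-0 xs)) (+-identityˡ 0ℝ)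

  +-interchange : ∀ a b c d → (a + b) + (c + d) ≡ (a + c) + (b + d)
  +-interchange a b c d = begin
    (a + b) + (c + d)  ≡⟨ +-assoc a b (c + d) ⟩
    a + (b + (c + d))  ≡⟨ cong (a +_) (sym (+-assoc b c d)) ⟩
    a + ((b + c) + d)  ≡⟨ cong (λ x → a + (x + d)) (+-comm b c) ⟩
    a + ((c + b) + d)  ≡⟨ cong (a +_) (+-assoc c b d) ⟩
    a + (c + (b + d))  ≡⟨ sym (+-assoc a c (b + d)) ⟩
    (a + c) + (b + d)  ∎
    where open ≡-Reasoning

  sumOver-+ : {A : Set} (φ ψ : A → Carrier) → ∀ xs →
    sumOver φ xs + sumOver ψ xs ≡ sumOver (λ p → φ p + ψ p) xs
  sumOver-+ φ ψ [] = +-identityˡ 0ℝ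
  sumOver-+ φ ψ (x ∷ xs) = trans (+-interchange (φ x) (sumOver φ xs) (ψ x) (sumOver ψ xs))
                                 (cong ((φ x + ψ x) +_) (sumOver-+ φ ψ xs))

  sumOver-filterᵇ : {A : Set} (P : A → Bool) (φ : A → Carrier) → ∀ xs →
    sumOver φ (filterᵇ P xs) ≡ sumOver (λ p → if P p then φ p else 0ℝ) xs
  sumOver-filterᵇ P φ [] = refl
  sumOver-filterᵇ P φ (x ∷ xs) with P x
  ... | true = cong (φ x +_) (sumOver-filterᵇ P φ xs)
  ... | false = trans (sumOver-filterᵇ P φ xs) (sym (+-identityˡ _))

  multiple : ℕ → Carrier → Carrier
  multiple zero e = 0ℝ
  multiple (suc m) e = e + multiple m e

  multiple-mono : ∀ {e} → 0ℝ ≤ e → ∀ {m k} → m ℕ.≤ k → multiple m e ≤ multiple k e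
  multiple-mono 0≤e {k = zero} z≤n = ≤-refl
  multiple-mono {e} 0≤e {k = suc k} z≤n =
    subst (_≤ e + multiple k e) (+-identityˡ 0ℝ) (+-mono-≤ 0≤e (multiple-mono 0≤e {k = k} z≤n))
  multiple-mono {e} 0≤e (s≤s m≤k) = +-monoʳ-≤ e (multiple-mono 0≤e m≤k)

  selected : Bool → Carrier → Carrier
  selected b e = if b then e else 0ℝ

  selected-+ : ∀ x y e → selected x e + selected y e ≡ multiple (indicator x ℕ.+ indicator y) e
  selected-+ true true e = cong (e +_) (sym (+-identityʳ e))
  selected-+ true false e = refl
  selected-+ false true e = +-comm 0ℝ e
  selected-+ false false e = +-identityˡ 0ℝ

  pairs-complete : ∀ u v → toℕ u ℕ.< toℕ v → (u , v) ∈ pairs ℝ n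
  pairs-complete u v u<v = ∈-filter⁺ (Bool.T? ∘ _) in-product (ℕ.<⇒<ᵇ u<v)
    where
    in-product : (u , v) ∈ concatMap (λ x → map (x ,_) (allFin n)) (allFin n)
    in-product = ∈-concatMap⁺ _ (Any.map (λ { refl → ∈-map⁺ (u ,_) (∈-allFin v) }) (∈-allFin u))

  weight : VSet n → Fin n × Fin n → Carrier
  weight A (u , v) = selected (adj G u v ∧ (A u xor A v)) (c u v)

  cap≡sum : ∀ A → cap A ≡ sumOver (weight A) (pairs ℝ n)
  cap≡sum A = sumOver-filterᵇ _ _ (pairs ℝ n)

  cap-cong : ∀ {A B} → (∀ v → A v ≡ B v) → cap A ≡ cap B
  cap-cong {A} {B} A≗B = trans (cap≡sum A) (trans (sumOver-cong same (pairs ℝ n)) (sym (cap≡sum B)))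
    where
    same : ∀ p → weight A p ≡ weight B p
    same (u , v) rewrite A≗B u | A≗B v = refl

  cap-complement : ∀ A → cap (not ∘ A) ≡ cap A
  cap-complement A = trans (cap≡sum (not ∘ A)) (trans (sumOver-cong same (pairs ℝ n)) (sym (cap≡sum A)))
    where
    same : ∀ p → weight (not ∘ A) p ≡ weight A p
    same (u , v) rewrite xor-annihilates-not (A u) (A v) = refl

  cap-∅ : cap (const false) ≡ 0ℝ
  cap-∅ = trans (cap≡sum (const false)) (trans (sumOver-cong zero-weight (pairs ℝ n)) (sumOver-0 (pairs ℝ n)))
    where
    zero-weight : ∀ p → weight (const false) p ≡ 0ℝ
    zero-weight (u , v) rewrite ∧-zeroʳ (adj G u v) = refl

  capacity-nonneg : ∀ u v → adj G u v ≡ true → 0ℝ ≤ c u v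
  capacity-nonneg u v e = inj₁ (proj₁ (pos u v e))

  weight-nonneg : ∀ A p → 0ℝ ≤ weight A p
  weight-nonneg A (u , v) with adj G u v in e | A u xor A v
  ... | false | _ = ≤-refl
  ... | true | true = capacity-nonneg u v e
  ... | true | false = ≤-refl

  cap-nonneg : ∀ A → 0ℝ ≤ cap A
  cap-nonneg A = subst₂ _≤_ (sumOver-0 (pairs ℝ n)) (sym (cap≡sum A))
                            (sumOver-mono (weight-nonneg A) (pairs ℝ n))

  cap-pos-ordered : ∀ A u v → toℕ u ℕ.< toℕ v → adj G u v ≡ true → (A u xor A v) ≡ true → 0ℝ < cap A
  cap-pos-ordered A u v u<v e sep = subst₂ _<_ (sumOver-0 (pairs ℝ n)) (sym (cap≡sum A))
    (sumOver-strict (weight-nonneg A) (pairs ℝ n) (pairs-complete u v u<v)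
      (subst (λ b → 0ℝ < selected b (c u v)) (sym (∧-true⁺ e sep)) (proj₁ (pos u v e))))

  cap-pos : ∀ A u v → adj G u v ≡ true → A u ≡ true → A v ≡ false → 0ℝ < cap A
  cap-pos A u v e au av with Fin.<-cmp u v
  ... | tri< u<v _ _ = cap-pos-ordered A u v u<v e (cong₂ _xor_ au av)
  ... | tri≈ _ refl _ = ⊥-elim (true≢false (trans (sym e) (adj-irr G u)))
  ... | tri> _ _ v<u = cap-pos-ordered A v u v<u (trans (adj-sym G v u) e) (cong₂ _xor_ av au)

  cap-+-mono : ∀ X₁ X₂ Y₁ Y₂ →
    (∀ u v → adj G u v ≡ true → crossings X₁ X₂ u v ℕ.≤ crossings Y₁ Y₂ u v) →
    cap X₁ + cap X₂ ≤ cap Y₁ + cap Y₂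
  cap-+-mono X₁ X₂ Y₁ Y₂ fewer = subst₂ _≤_ (sym (sum-of X₁ X₂)) (sym (sum-of Y₁ Y₂))
                                             (sumOver-mono pointwise (pairs ℝ n))
    where
    sum-of : ∀ A B → cap A + cap B ≡ sumOver (λ p → weight A p + weight B p) (pairs ℝ n)
    sum-of A B = trans (cong₂ _+_ (cap≡sum A) (cap≡sum B)) (sumOver-+ (weight A) (weight B) (pairs ℝ n))
    pointwise : ∀ p → weight X₁ p + weight X₂ p ≤ weight Y₁ p + weight Y₂ p
    pointwise (u , v) with adj G u v in e
    ... | false = ≤-refl
    ... | true = subst₂ _≤_ (sym (selected-+ (X₁ u xor X₁ v) (X₂ u xor X₂ v) (c u v)))
                            (sym (selected-+ (Y₁ u xor Y₁ v) (Y₂ u xor Y₂ v) (c u v)))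
                            (multiple-mono (capacity-nonneg u v e) (fewer u v e))

-- Minimum cuts and the exchange argument

-- With R ⊆ A closed under the edges inside A, every edge is cut by R and A ∖ R
-- exactly as often as by A.
crossings-closed-split : ∀ a r a′ r′ → (r ≡ true → a ≡ true) → (r′ ≡ true → a′ ≡ true) →
  (r ≡ true → a′ ≡ true → r′ ≡ true) → (r′ ≡ true → a ≡ true → r ≡ true) →
  indicator (r xor r′) ℕ.+ indicator ((a ∧ not r) xor (a′ ∧ not r′)) ℕ.≤
  indicator (a xor a′) ℕ.+ indicator (false xor false)
crossings-closed-split false true _ _ r⊆a _ _ _ = ⊥-elim (true≢false (sym (r⊆a refl)))
crossings-closed-split _ _ false true _ r′⊆a′ _ _ = ⊥-elim (true≢false (sym (r′⊆a′ refl)))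
crossings-closed-split true true true false _ _ closed _ = ⊥-elim (true≢false (sym (closed refl refl)))
crossings-closed-split true false true true _ _ _ closed′ = ⊥-elim (true≢false (sym (closed′ refl refl)))
crossings-closed-split true true true true _ _ _ _ = ℕ.≤-refl
crossings-closed-split true false true false _ _ _ _ = ℕ.≤-refl
crossings-closed-split true true false false _ _ _ _ = ℕ.≤-refl
crossings-closed-split true false false false _ _ _ _ = ℕ.≤-refl
crossings-closed-split false false true true _ _ _ _ = ℕ.≤-refl
crossings-closed-split false false true false _ _ _ _ = ℕ.≤-refl
crossings-closed-split false false false false _ _ _ _ = ℕ.≤-refl

-- Around an inner bag, pieces 0 and 3 are two sides S and T, and 1 / 2 the part
-- of the bag that is / is not reached from its terminal.
innerPiece : Bool → Bool → Bool → Fin 4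
innerPiece true _ _ = 0F
innerPiece false true _ = 3F
innerPiece false false true = 1F
innerPiece false false false = 2F

innerPiece≡1 : ∀ x y b → innerPiece x y b ≡ 1F → x ≡ false × y ≡ false × b ≡ true
innerPiece≡1 false false true _ = refl , refl , refl

innerPiece≡2 : ∀ x y b → innerPiece x y b ≡ 2F → x ≡ false × y ≡ false × b ≡ false
innerPiece≡2 false false false _ = refl , refl , refl

innerPiece-S : ∀ x y b → (x ≡ true → y ≡ false) → ⟦ 0F ∷ [] ⟧ (innerPiece x y b) ≡ x
innerPiece-S true _ _ _ = refl
innerPiece-S false true _ _ = refl
innerPiece-S false false true _ = refl
innerPiece-S false false false _ = refl

innerPiece-T : ∀ x y b → (x ≡ true → y ≡ false) → ⟦ 3F ∷ [] ⟧ (innerPiece x y b) ≡ y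
innerPiece-T true _ _ disjoint = sym (disjoint refl)
innerPiece-T false true _ _ = refl
innerPiece-T false false true _ = refl
innerPiece-T false false false _ = refl

-- At a leaf bag B(s) next to B(t): 0 = B(s), 1 = B(t), 2 = the rest.
leafPiece : Bool → Bool → Fin 3
leafPiece true _ = 0F
leafPiece false true = 1F
leafPiece false false = 2F

leafPiece≡0 : ∀ x y → leafPiece x y ≡ 0F → x ≡ true
leafPiece≡0 true _ _ = refl
leafPiece≡0 false true ()
leafPiece≡0 false false ()

leafPiece≡1 : ∀ x y → leafPiece x y ≡ 1F → y ≡ true
leafPiece≡1 false true _ = refl
leafPiece≡1 true _ ()
leafPiece≡1 false false ()

leafPiece-rest : ∀ x y → ⟦ 2F ∷ [] ⟧ (leafPiece x y) ≡ not (x ∨ y)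
leafPiece-rest true _ = refl
leafPiece-rest false true = refl
leafPiece-rest false false = refl

-- In a star with centre 0: 0 / 1 = the part of B(0) that is / is not reached
-- from its terminal, and 2, 3, 4 = the leaf bags B(1), B(2), B(3).
starPiece : Fin 4 → Bool → Fin 5
starPiece 0F true = 0F
starPiece 0F false = 1F
starPiece 1F _ = 2F
starPiece 2F _ = 3F
starPiece 3F _ = 4F

starPiece≡0 : ∀ j b → starPiece j b ≡ 0F → j ≡ 0F × b ≡ true
starPiece≡0 0F true _ = refl , refl
starPiece≡0 0F false ()
starPiece≡0 1F _ ()
starPiece≡0 2F _ ()
starPiece≡0 3F _ ()

starPiece≡1 : ∀ j b → starPiece j b ≡ 1F → j ≡ 0F × b ≡ false
starPiece≡1 0F false _ = refl , refl
starPiece≡1 0F true ()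
starPiece≡1 1F _ ()
starPiece≡1 2F _ ()
starPiece≡1 3F _ ()

starPiece≡2 : ∀ j b → starPiece j b ≡ 2F → j ≡ 1F
starPiece≡2 1F _ _ = refl
starPiece≡2 0F true ()
starPiece≡2 0F false ()
starPiece≡2 2F _ ()
starPiece≡2 3F _ ()

starPiece-leaf₂ : ∀ j b → ⟦ 3F ∷ [] ⟧ (starPiece j b) ≡ ⟦ 2F ∷ [] ⟧ j
starPiece-leaf₂ 0F true = refl
starPiece-leaf₂ 0F false = refl
starPiece-leaf₂ 1F _ = refl
starPiece-leaf₂ 2F _ = refl
starPiece-leaf₂ 3F _ = refl

starPiece-leaf₃ : ∀ j b → ⟦ 4F ∷ [] ⟧ (starPiece j b) ≡ ⟦ 3F ∷ [] ⟧ j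
starPiece-leaf₃ 0F true = refl
starPiece-leaf₃ 0F false = refl
starPiece-leaf₃ 1F _ = refl
starPiece-leaf₃ 2F _ = refl
starPiece-leaf₃ 3F _ = refl

module MinimumCuts (ℝ : Reals) {n : ℕ} (G : Graph n) (conn : Connected (adj G))
                   (c : Fin n → Fin n → Reals.Carrier ℝ) (pos : PositiveCapacity ℝ G c) where
  open Reals ℝ
  open OrderedAddition ℝ
  open CutCapacity ℝ G c pos public

  MinCut : Fin n → Fin n → VSet n → Set
  MinCut = IsMinCut ℝ G c

  MinCut-resp : ∀ {s t A B} → MinCut s t A → (∀ v → A v ≡ B v) → MinCut s t B
  MinCut-resp {s} {t} (as , at , minimal) A≗B =
    trans (sym (A≗B s)) as , trans (sym (A≗B t)) at , λ C cs ct → subst (_≤ cap C) (cap-cong A≗B) (minimal C cs ct)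

  separating-edge : ∀ (X : VSet n) {P u v} → Walk (adj G) P u v → X u ≡ true → X v ≡ false →
    ∃ λ x → ∃ λ y → adj G x y ≡ true × X x ≡ true × X y ≡ false
  separating-edge X (here _) xu xv = ⊥-elim (true≢false (trans (sym xu) xv))
  separating-edge X (step {v = y} _ e rest) xu xv with X y in xy
  ... | true = separating-edge X rest xy xv
  ... | false = _ , y , e , xu , xy

  cap-pos-separating : ∀ (X : VSet n) u v → X u ≡ true → X v ≡ false → 0ℝ < cap X
  cap-pos-separating X u v xu xv =
    let (x , y , e , xx , xy) = separating-edge X (conn u v refl refl) xu xv in cap-pos X x y e xx xy

  -- If A were not connected, the part R reachable from s inside A would be a
  -- cheaper st-cut: c(δ(R)) + c(δ(A ∖ R)) ≤ c(δ(A)) and c(δ(A ∖ R)) > 0.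
  minCut-connected : ∀ {s t A} → MinCut s t A → InducedConnected (adj G) A
  minCut-connected {s} {t} {A} (as , at , minimal) =
      InducedConnected-from s (adj-sym G) (λ v av → walk-weaken reach-⊆ (reach-walk v (reached v av)))
    where
    open Reachability (adj G) A s

    rest : VSet n
    rest x = A x ∧ not (reach x)

    unreached-t : reach t ≡ false
    unreached-t with reach t in rt
    ... | true = ⊥-elim (true≢false (trans (sym (reach-⊆ t rt)) at))
    ... | false = refl

    split : cap reach + cap rest ≤ cap A + cap (const false)
    split = cap-+-mono reach rest A (const false) λ x y e →
      crossings-closed-split (A x) (reach x) (A y) (reach y) (reach-⊆ x) (reach-⊆ y)
        (λ rx ay → reach-closed x y rx ay e) (λ ry ax → reach-closed y x ry ax (trans (adj-sym G y x) e))

    reached : ∀ v → A v ≡ true → reach v ≡ true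
    reached v av with reach v in rv
    ... | true = refl
    ... | false = ⊥-elim (<-irrefl (<-≤-trans (+-monoʳ-< (cap reach) rest-pos) (≤-trans split A≤R)))
      where
      rest-pos : 0ℝ < cap rest
      rest-pos = cap-pos-separating rest v t (cong₂ (λ x y → x ∧ not y) av rv) (cong (_∧ not (reach t)) at)
      A≤R : cap A + cap (const false) ≤ cap reach + 0ℝ
      A≤R = subst (λ x → cap A + x ≤ cap reach + 0ℝ) (sym cap-∅)
                  (+-monoˡ-≤ 0ℝ (minimal reach (reach-source as) unreached-t))

  minCut-central : ∀ {s t A} → MinCut s t A → Central ℝ G A
  minCut-central {s} {t} {A} A-min@(as , at , minimal) = minCut-connected A-min , minCut-connected complement-min
    where
    complement-min : MinCut t s (not ∘ A)
    complement-min = cong not at , cong not as , λ B bt bs →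
      subst₂ _≤_ (sym (cap-complement A)) (cap-complement B) (minimal (not ∘ B) (cong not bs) (cong not bt))

  sameCut⇒≗ : ∀ {A B} → SameCut ℝ G A B → ∀ s → A s ≡ B s → ∀ v → A v ≡ B v
  sameCut⇒≗ {A} {B} same s As≡Bs v = along (conn s v refl refl) As≡Bs
    where
    xor-cancel : ∀ a b x y → a ≡ b → (a xor x) ≡ (b xor y) → x ≡ y
    xor-cancel true true true true refl _ = refl
    xor-cancel true true false false refl _ = refl
    xor-cancel true true true false refl ()
    xor-cancel true true false true refl ()
    xor-cancel false false x y refl h = h
    along : ∀ {x} → Walk (adj G) (const true) x v → A x ≡ B x → A v ≡ B v
    along (here _) e = e
    along (step {u = x} {v = y} _ xy rest) e = along rest (xor-cancel (A x) (B x) (A y) (B y) e (same x y xy))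

  module Exchange (distinct : DistinctCentralCapacities ℝ G c) where

    exchange : ∀ {s t X₁ X₂ Y₁ Y₂} → MinCut s t Y₁ → X₁ s ≡ true → X₁ t ≡ false →
      cap Y₂ ≤ cap X₂ → cap X₁ + cap X₂ ≤ cap Y₁ + cap Y₂ → ∀ v → X₁ v ≡ Y₁ v
    exchange {s} {t} {X₁} {Y₁ = Y₁} Y₁-min@(ys , _ , minimal) xs xt Y₂≤X₂ X≤Y =
      sameCut⇒≗ (distinct X₁ Y₁ (minCut-central X₁-min) (minCut-central Y₁-min) same-cap) s (trans xs (sym ys))
      where
      same-cap : cap X₁ ≡ cap Y₁
      same-cap = +-squeezeˡ (minimal X₁ xs xt) Y₂≤X₂ X≤Y
      X₁-min : MinCut s t X₁
      X₁-min = xs , xt , λ B bs bt → subst (_≤ cap B) (sym same-cap) (minimal B bs bt)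

    NoEdgesBetween : ∀ {r} → (Fin n → Fin r) → Fin r × Fin r → Set
    NoEdgesBetween ρ (i , j) = ∀ u v → adj G u v ≡ true → ρ u ≡ i → ρ v ≡ j → ⊥

    -- exchange for sets that are unions of regions ρ⁻¹(i): the counting condition
    -- is then a finite check over pairs of regions, except those known to have no
    -- edges between them.
    exchange-regions : ∀ {r} (ρ : Fin n → Fin r) (X₁ X₂ Y₁ Y₂ : Fin r → Bool) (ps : List (Fin r × Fin r)) →
      All (NoEdgesBetween ρ) ps → True (crossingsDominated? X₁ X₂ Y₁ Y₂ ps) →
      ∀ {s t} → MinCut s t (Y₁ ∘ ρ) → X₁ (ρ s) ≡ true → X₁ (ρ t) ≡ false →
      cap (Y₂ ∘ ρ) ≤ cap (X₂ ∘ ρ) → ∀ v → X₁ (ρ v) ≡ Y₁ (ρ v)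
    exchange-regions ρ X₁ X₂ Y₁ Y₂ ps no-edges dominated Y₁-min xs xt Y₂≤X₂ =
      exchange {X₂ = X₂ ∘ ρ} {Y₂ = Y₂ ∘ ρ} Y₁-min xs xt Y₂≤X₂
        (cap-+-mono (X₁ ∘ ρ) (X₂ ∘ ρ) (Y₁ ∘ ρ) (Y₂ ∘ ρ) λ u v e → toWitness dominated (ρ u) (ρ v) (avoids u v e))
      where
      avoids : ∀ u v → adj G u v ≡ true → Avoids ps (ρ u) (ρ v)
      avoids u v e = (λ uv∈ps → All.lookup no-edges uv∈ps u v e refl refl)
                   , (λ vu∈ps → All.lookup no-edges vu∈ps v u (trans (adj-sym G v u) e) refl refl)

    module Bags {K : ℕ} (region : Fin n → Fin K) (terminal : Fin K → Fin n)
                (region-terminal : ∀ j → region (terminal j) ≡ j) where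

      Bag : Fin K → VSet n
      Bag j v = ⌊ region v ≟ j ⌋

      Bag-∋ : ∀ {j v} → region v ≡ j → Bag j v ≡ true
      Bag-∋ {j} refl = ≟-refl j

      EdgeBetween : Fin K → Fin K → Set
      EdgeBetween i j = ∃ λ u → ∃ λ v → region u ≡ i × region v ≡ j × adj G u v ≡ true

      EdgeBetween-sym : ∀ {i j} → EdgeBetween i j → EdgeBetween j i
      EdgeBetween-sym (u , v , ru , rv , e) = v , u , rv , ru , trans (adj-sym G v u) e

      edgeBetween? : ∀ i j → Dec (EdgeBetween i j)
      edgeBetween? i j = Fin.any? λ u → Fin.any? λ v →
        (region u Fin.≟ i) ×-dec ((region v Fin.≟ j) ×-dec (adj G u v Bool.≟ true))

      no-edges-between : ∀ {r} (ρ : Fin n → Fin r) {i j a b} → ¬ EdgeBetween a b →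
        (∀ u → ρ u ≡ i → region u ≡ a) → (∀ v → ρ v ≡ j → region v ≡ b) → NoEdgesBetween ρ (i , j)
      no-edges-between ρ ¬ab in-a in-b u v e ρu ρv = ¬ab (u , v , in-a u ρu , in-b v ρv , e)

      leafBag-connected : ∀ {s t} j → MinCut s t (⟦ j ∷ [] ⟧ ∘ region) → InducedConnected (adj G) (Bag j)
      leafBag-connected j j-min = InducedConnected-resp (λ v → ⟦⟧-single (region v)) (minCut-connected j-min)

      -- S and T are the far sides of two tree edges at m.  The part U of B(m) not
      -- reachable from its terminal has edges only to S and T, so
      -- c(δ(S ∪ U)) + c(δ(T ∪ U)) ≤ c(δ(S)) + c(δ(T)) and the exchange gives S ∪ U = S.
      innerBag-connected : (S T : Fin K → Bool) (m s t : Fin K) → S m ≡ false → T m ≡ false →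
        (∀ j → S j ≡ false → T j ≡ false → j ≡ m) → (∀ j → S j ≡ true → T j ≡ false) →
        S s ≡ true → T t ≡ true →
        MinCut (terminal s) (terminal m) (S ∘ region) → MinCut (terminal t) (terminal m) (T ∘ region) →
        InducedConnected (adj G) (Bag m)
      innerBag-connected S T m s t Sm Tm covers disjoint Ss Tt S-min T-min =
          InducedConnected-from (terminal m) (adj-sym G) (λ v bv → walk-weaken reach-⊆ (reach-walk v (reached v bv)))
        where
        open Reachability (adj G) (Bag m) (terminal m)

        ρ : Fin n → Fin 4
        ρ v = innerPiece (S (region v)) (T (region v)) (reach v)

        ρ-at : ∀ {v j} → region v ≡ j → ρ v ≡ innerPiece (S j) (T j) (reach v)
        ρ-at {v} = cong (λ j → innerPiece (S j) (T j) (reach v))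

        ρ-inBag : ∀ {v} → region v ≡ m → ρ v ≡ innerPiece false false (reach v)
        ρ-inBag {v} rv = trans (ρ-at rv) (cong₂ (λ x y → innerPiece x y (reach v)) Sm Tm)

        reached-terminal : reach (terminal m) ≡ true
        reached-terminal = reach-source (Bag-∋ (region-terminal m))

        closed : NoEdgesBetween ρ (1F , 2F)
        closed u v e ρu ρv =
          let (_ , _ , ru) = innerPiece≡1 _ _ _ ρu
              (Sv , Tv , rv) = innerPiece≡2 _ _ _ ρv
          in true≢false (trans (sym (reach-closed u v ru (Bag-∋ (covers (region v) Sv Tv)) e)) rv)

        X₁ X₂ : Fin 4 → Bool
        X₁ = ⟦ 0F ∷ 2F ∷ [] ⟧
        X₂ = ⟦ 2F ∷ 3F ∷ [] ⟧

        S-min′ : MinCut (terminal s) (terminal m) (⟦ 0F ∷ [] ⟧ ∘ ρ)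
        S-min′ = MinCut-resp S-min (λ v → sym (innerPiece-S _ _ (reach v) (disjoint (region v))))

        St : S t ≡ false
        St with S t in e
        ... | true = ⊥-elim (true≢false (trans (sym Tt) (disjoint t e)))
        ... | false = refl

        ρ-terminal-m : ρ (terminal m) ≡ 1F
        ρ-terminal-m = trans (ρ-inBag (region-terminal m)) (cong (innerPiece false false) reached-terminal)

        T≤X₂ : cap (⟦ 3F ∷ [] ⟧ ∘ ρ) ≤ cap (X₂ ∘ ρ)
        T≤X₂ = subst (_≤ cap (X₂ ∘ ρ)) (cap-cong (λ v → sym (innerPiece-T _ _ (reach v) (disjoint (region v)))))
          (proj₂ (proj₂ T-min) (X₂ ∘ ρ)
            (cong X₂ (trans (ρ-at (region-terminal t)) (cong₂ (λ x y → innerPiece x y _) St Tt)))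
            (cong X₂ ρ-terminal-m))

        reached : ∀ v → Bag m v ≡ true → reach v ≡ true
        reached v bv with reach v in rv
        ... | true = refl
        ... | false = ⊥-elim (true≢false (trans (sym (cong X₁ ρv≡2))
            (trans (exchange-regions ρ X₁ X₂ ⟦ 0F ∷ [] ⟧ ⟦ 3F ∷ [] ⟧ ((1F , 2F) ∷ []) (closed All.∷ All.[]) tt
                      S-min′ (cong X₁ (trans (ρ-at (region-terminal s)) (cong (λ x → innerPiece x (T s) _) Ss)))
                      (cong X₁ ρ-terminal-m)
                      T≤X₂ v)
                   (cong ⟦ 0F ∷ [] ⟧ ρv≡2))))
          where
          ρv≡2 : ρ v ≡ 2F
          ρv≡2 = trans (ρ-inBag (≟⇒≡ bv)) (cong (innerPiece false false) rv)

      -- s is a leaf at t and R is the far side of another tree edge rt.  Without an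
      -- edge between B(s) and B(t): c(δ(R ∪ B(s))) + c(δ(B(s))) ≤ c(δ(R)).
      leaf-edge : (R : Fin K → Bool) (s t r : Fin K) → s ≢ t →
        (∀ j → R j ≡ not (⌊ j ≟ s ⌋ ∨ ⌊ j ≟ t ⌋)) → MinCut (terminal r) (terminal t) (R ∘ region) →
        EdgeBetween s t
      leaf-edge R s t r s≢t R≗ R-min with edgeBetween? s t
      ... | yes st = st
      ... | no ¬st = ⊥-elim (true≢false (trans (sym (cong X₁ ρ-terminal-s))
            (trans (exchange-regions ρ X₁ ⟦ 0F ∷ [] ⟧ Y₁ ⟦ [] ⟧ ((0F , 1F) ∷ []) (no-edges All.∷ All.[]) tt
                      R-min′ (Y⊆X (proj₁ R-min′)) X₁-terminal-t Y₂≤X₂ (terminal s))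
                   (cong Y₁ ρ-terminal-s))))
        where
        ρ : Fin n → Fin 3
        ρ v = leafPiece (Bag s v) (Bag t v)

        X₁ Y₁ : Fin 3 → Bool
        X₁ = ⟦ 0F ∷ 2F ∷ [] ⟧
        Y₁ = ⟦ 2F ∷ [] ⟧

        no-edges : NoEdgesBetween ρ (0F , 1F)
        no-edges = no-edges-between ρ ¬st (λ u p → ≟⇒≡ (leafPiece≡0 _ _ p)) (λ v q → ≟⇒≡ (leafPiece≡1 _ _ q))

        R-min′ : MinCut (terminal r) (terminal t) (Y₁ ∘ ρ)
        R-min′ = MinCut-resp R-min (λ v → trans (R≗ (region v)) (sym (leafPiece-rest (Bag s v) (Bag t v))))

        Y⊆X : ∀ {i} → Y₁ i ≡ true → X₁ i ≡ true
        Y⊆X {2F} _ = refl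

        Bag-terminal : ∀ i j → Bag i (terminal j) ≡ ⌊ j ≟ i ⌋
        Bag-terminal i j = cong (λ x → ⌊ x ≟ i ⌋) (region-terminal j)

        ρ-terminal-s : ρ (terminal s) ≡ 0F
        ρ-terminal-s = cong (λ x → leafPiece x (Bag t (terminal s))) (trans (Bag-terminal s s) (≟-refl s))

        X₁-terminal-t : X₁ (ρ (terminal t)) ≡ false
        X₁-terminal-t = cong X₁ (cong₂ leafPiece (trans (Bag-terminal s t) (≟-≢ (s≢t ∘ sym)))
                                            (trans (Bag-terminal t t) (≟-refl t)))

        Y₂≤X₂ : cap (⟦ [] ⟧ ∘ ρ) ≤ cap (⟦ 0F ∷ [] ⟧ ∘ ρ)
        Y₂≤X₂ = subst (_≤ cap (⟦ 0F ∷ [] ⟧ ∘ ρ)) (sym cap-∅) (cap-nonneg (⟦ 0F ∷ [] ⟧ ∘ ρ))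

    module Bags₄ (region : Fin n → Fin 4) (terminal : Fin 4 → Fin n)
                 (region-terminal : ∀ j → region (terminal j) ≡ j) where
      open Bags region terminal region-terminal

      at-terminal : ∀ (M : Fin 4 → Bool) j → M (region (terminal j)) ≡ M j
      at-terminal M j = cong M (region-terminal j)

      -- In the path 0 – 1 – 2 – 3 without an edge between B(1) and B(2):
      -- c(δ(B(0) ∪ B(2) ∪ B(3))) + c(δ(B(0) ∪ B(1) ∪ B(3))) ≤ c(δ(B(0))) + c(δ(B(3))).
      path-middle-edge : MinCut (terminal 0F) (terminal 1F) (⟦ 0F ∷ [] ⟧ ∘ region) →
        MinCut (terminal 3F) (terminal 2F) (⟦ 3F ∷ [] ⟧ ∘ region) → EdgeBetween 1F 2F
      path-middle-edge B₀-min B₃-min with edgeBetween? 1F 2F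
      ... | yes e = e
      ... | no ¬e = ⊥-elim (true≢false (trans (sym (at-terminal X₁ 2F))
            (trans (exchange-regions region X₁ X₂ ⟦ 0F ∷ [] ⟧ ⟦ 3F ∷ [] ⟧ ((1F , 2F) ∷ [])
                      (no-edges-between region ¬e (λ _ → id) (λ _ → id) All.∷ All.[]) tt
                      B₀-min (at-terminal X₁ 0F) (at-terminal X₁ 1F) Y₂≤X₂ (terminal 2F))
                   (at-terminal ⟦ 0F ∷ [] ⟧ 2F))))
        where
        X₁ X₂ : Fin 4 → Bool
        X₁ = ⟦ 0F ∷ 2F ∷ 3F ∷ [] ⟧
        X₂ = ⟦ 0F ∷ 1F ∷ 3F ∷ [] ⟧
        Y₂≤X₂ : cap (⟦ 3F ∷ [] ⟧ ∘ region) ≤ cap (X₂ ∘ region)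
        Y₂≤X₂ = proj₂ (proj₂ B₃-min) (X₂ ∘ region) (at-terminal X₂ 3F) (at-terminal X₂ 2F)

      ReachedEdge : Fin 4 → Set
      ReachedEdge j = ∃ λ u → ∃ λ v → region u ≡ 0F × region v ≡ j × adj G u v ≡ true ×
                                      Walk (adj G) (Bag 0F) (terminal 0F) u

      StarBags : Set
      StarBags = (∀ j → j ≢ 0F → InducedConnected (adj G) (Bag j)) × (∀ j → j ≢ 0F → ReachedEdge j)

      -- In the star with centre 0 and U the part of B(0) not reachable from its
      -- terminal, without an edge between B(0) ∖ U and B(1):
      -- c(δ(U ∪ B(1) ∪ B(2))) + c(δ(U ∪ B(1) ∪ B(3))) ≤ c(δ(B(2))) + c(δ(B(3))).
      star-edge : MinCut (terminal 2F) (terminal 0F) (⟦ 2F ∷ [] ⟧ ∘ region) →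
        MinCut (terminal 3F) (terminal 0F) (⟦ 3F ∷ [] ⟧ ∘ region) → ReachedEdge 1F
      star-edge B₂-min B₃-min = conclude edge?
        where
        open Reachability (adj G) (Bag 0F) (terminal 0F)

        ReachedCandidate : Set
        ReachedCandidate = ∃ λ u → ∃ λ v → region u ≡ 0F × reach u ≡ true × region v ≡ 1F × adj G u v ≡ true

        edge? : Dec ReachedCandidate
        edge? = Fin.any? λ u → Fin.any? λ v →
          (region u Fin.≟ 0F) ×-dec ((reach u Bool.≟ true) ×-dec ((region v Fin.≟ 1F) ×-dec (adj G u v Bool.≟ true)))

        ρ : Fin n → Fin 5
        ρ v = starPiece (region v) (reach v)

        X₁ X₂ : Fin 5 → Bool
        X₁ = ⟦ 1F ∷ 2F ∷ 3F ∷ [] ⟧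
        X₂ = ⟦ 1F ∷ 2F ∷ 4F ∷ [] ⟧

        closed : NoEdgesBetween ρ (0F , 1F)
        closed u v e ρu ρv =
          let (_ , ru) = starPiece≡0 _ _ ρu
              (r₀ , rv) = starPiece≡1 _ _ ρv
          in true≢false (trans (sym (reach-closed u v ru (Bag-∋ r₀) e)) rv)

        no-edge : ¬ ReachedCandidate → NoEdgesBetween ρ (0F , 2F)
        no-edge ¬e u v e ρu ρv =
          let (r₀ , ru) = starPiece≡0 _ _ ρu in ¬e (u , v , r₀ , ru , starPiece≡2 _ _ ρv , e)

        ρ-terminal : ∀ (M : Fin 5 → Bool) j → M (ρ (terminal j)) ≡ M (starPiece j (reach (terminal j)))
        ρ-terminal M j = cong (λ i → M (starPiece i (reach (terminal j)))) (region-terminal j)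

        ρ-centre : ∀ (M : Fin 5 → Bool) → M 0F ≡ false → M (ρ (terminal 0F)) ≡ false
        ρ-centre M M₀ = trans (ρ-terminal M 0F)
          (trans (cong (M ∘ starPiece 0F) (reach-source (Bag-∋ (region-terminal 0F)))) M₀)

        B₂-min′ : MinCut (terminal 2F) (terminal 0F) (⟦ 3F ∷ [] ⟧ ∘ ρ)
        B₂-min′ = MinCut-resp B₂-min (λ v → sym (starPiece-leaf₂ (region v) (reach v)))

        Y₂≤X₂ : cap (⟦ 4F ∷ [] ⟧ ∘ ρ) ≤ cap (X₂ ∘ ρ)
        Y₂≤X₂ = subst (_≤ cap (X₂ ∘ ρ)) (cap-cong (λ v → sym (starPiece-leaf₃ (region v) (reach v))))
                  (proj₂ (proj₂ B₃-min) (X₂ ∘ ρ) (ρ-terminal X₂ 3F) (ρ-centre X₂ refl))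

        conclude : Dec ReachedCandidate → ReachedEdge 1F
        conclude (yes (u , v , ru , reached , rv , e)) = u , v , ru , rv , e , walk-weaken reach-⊆ (reach-walk u reached)
        conclude (no ¬e) = ⊥-elim (true≢false (trans (sym (ρ-terminal X₁ 1F))
          (trans (exchange-regions ρ X₁ X₂ ⟦ 3F ∷ [] ⟧ ⟦ 4F ∷ [] ⟧ ((0F , 1F) ∷ (0F , 2F) ∷ [])
                    (closed All.∷ no-edge ¬e All.∷ All.[]) tt
                    B₂-min′ (ρ-terminal X₁ 2F) (ρ-centre X₁ refl) Y₂≤X₂ (terminal 1F))
                 (ρ-terminal ⟦ 3F ∷ [] ⟧ 1F))))

    module _ {K : ℕ} (region : Fin n → Fin K) (terminal : Fin K → Fin n)
             (region-terminal : ∀ j → region (terminal j) ≡ j) where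
      open Bags region terminal region-terminal

      PathBags : Set
      PathBags = (∀ j → InducedConnected (adj G) (Bag j)) × (∀ a b → suc (toℕ a) ≡ toℕ b → EdgeBetween a b)

    path₂ : (region : Fin n → Fin 2) (terminal : Fin 2 → Fin n) (region-terminal : ∀ j → region (terminal j) ≡ j) →
      MinCut (terminal 0F) (terminal 1F) (⟦ 0F ∷ [] ⟧ ∘ region) →
      MinCut (terminal 1F) (terminal 0F) (⟦ 1F ∷ [] ⟧ ∘ region) → PathBags region terminal region-terminal
    path₂ region terminal region-terminal B₀-min B₁-min = connected , edges
      where
      open Bags region terminal region-terminal
      connected : ∀ j → InducedConnected (adj G) (Bag j)
      connected 0F = leafBag-connected 0F B₀-min
      connected 1F = leafBag-connected 1F B₁-min
      other : ∀ (j : Fin 2) → ⟦ 0F ∷ [] ⟧ j ≡ false → j ≡ 1F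
      other 1F _ = refl
      edges : ∀ a b → suc (toℕ a) ≡ toℕ b → EdgeBetween a b
      edges 0F 1F refl =
        let (u , v , e , in₀ , out₀) = separating-edge (⟦ 0F ∷ [] ⟧ ∘ region)
              (conn (terminal 0F) (terminal 1F) refl refl) (proj₁ B₀-min) (proj₁ (proj₂ B₀-min))
        in u , v , ⟦⟧-single⇒≡ in₀ , other (region v) out₀ , e

    path₃ : (region : Fin n → Fin 3) (terminal : Fin 3 → Fin n) (region-terminal : ∀ j → region (terminal j) ≡ j) →
      MinCut (terminal 0F) (terminal 1F) (⟦ 0F ∷ [] ⟧ ∘ region) →
      MinCut (terminal 2F) (terminal 1F) (⟦ 2F ∷ [] ⟧ ∘ region) → PathBags region terminal region-terminal
    path₃ region terminal region-terminal B₀-min B₂-min = connected , edges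
      where
      open Bags region terminal region-terminal
      connected : ∀ j → InducedConnected (adj G) (Bag j)
      connected 0F = leafBag-connected 0F B₀-min
      connected 1F = innerBag-connected ⟦ 0F ∷ [] ⟧ ⟦ 2F ∷ [] ⟧ 1F 0F 2F refl refl
        (λ { 0F () _ ; 1F _ _ → refl ; 2F _ () }) (λ { 0F _ → refl ; 1F () ; 2F () })
        refl refl B₀-min B₂-min
      connected 2F = leafBag-connected 2F B₂-min
      edges : ∀ a b → suc (toℕ a) ≡ toℕ b → EdgeBetween a b
      edges 0F 1F refl = leaf-edge ⟦ 2F ∷ [] ⟧ 0F 1F 2F (λ ()) (λ { 0F → refl ; 1F → refl ; 2F → refl }) B₂-min
      edges 1F 2F refl =
        EdgeBetween-sym (leaf-edge ⟦ 0F ∷ [] ⟧ 2F 1F 0F (λ ()) (λ { 0F → refl ; 1F → refl ; 2F → refl }) B₀-min)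

    path₄ : (region : Fin n → Fin 4) (terminal : Fin 4 → Fin n) (region-terminal : ∀ j → region (terminal j) ≡ j) →
      MinCut (terminal 0F) (terminal 1F) (⟦ 0F ∷ [] ⟧ ∘ region) →
      MinCut (terminal 2F) (terminal 1F) (⟦ 2F ∷ 3F ∷ [] ⟧ ∘ region) →
      MinCut (terminal 1F) (terminal 2F) (⟦ 0F ∷ 1F ∷ [] ⟧ ∘ region) →
      MinCut (terminal 3F) (terminal 2F) (⟦ 3F ∷ [] ⟧ ∘ region) → PathBags region terminal region-terminal
    path₄ region terminal region-terminal B₀-min B₂₃-min B₀₁-min B₃-min = connected , edges
      where
      open Bags region terminal region-terminal
      open Bags₄ region terminal region-terminal using (path-middle-edge)
      connected : ∀ j → InducedConnected (adj G) (Bag j)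
      connected 0F = leafBag-connected 0F B₀-min
      connected 1F = innerBag-connected ⟦ 0F ∷ [] ⟧ ⟦ 2F ∷ 3F ∷ [] ⟧ 1F 0F 2F refl refl
        (λ { 0F () _ ; 1F _ _ → refl ; 2F _ () ; 3F _ () }) (λ { 0F _ → refl ; 1F () ; 2F () ; 3F () })
        refl refl B₀-min B₂₃-min
      connected 2F = innerBag-connected ⟦ 3F ∷ [] ⟧ ⟦ 0F ∷ 1F ∷ [] ⟧ 2F 3F 1F refl refl
        (λ { 0F _ () ; 1F _ () ; 2F _ _ → refl ; 3F () _ }) (λ { 0F () ; 1F () ; 2F () ; 3F _ → refl })
        refl refl B₃-min B₀₁-min
      connected 3F = leafBag-connected 3F B₃-min
      edges : ∀ a b → suc (toℕ a) ≡ toℕ b → EdgeBetween a b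
      edges 0F 1F refl =
        leaf-edge ⟦ 2F ∷ 3F ∷ [] ⟧ 0F 1F 2F (λ ()) (λ { 0F → refl ; 1F → refl ; 2F → refl ; 3F → refl }) B₂₃-min
      edges 1F 2F refl = path-middle-edge B₀-min B₃-min
      edges 2F 3F refl = EdgeBetween-sym
        (leaf-edge ⟦ 0F ∷ 1F ∷ [] ⟧ 3F 2F 1F (λ ()) (λ { 0F → refl ; 1F → refl ; 2F → refl ; 3F → refl }) B₀₁-min)

    module Relabel (region : Fin n → Fin 4) (terminal : Fin 4 → Fin n)
                   (region-terminal : ∀ j → region (terminal j) ≡ j)
                   (π : Permutation 4 4) (π-fixes-0 : π ⟨$⟩ʳ 0F ≡ 0F) where

      region′ : Fin n → Fin 4
      region′ = (π ⟨$⟩ʳ_) ∘ region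

      terminal′ : Fin 4 → Fin n
      terminal′ = terminal ∘ (π ⟨$⟩ˡ_)

      region′-terminal′ : ∀ j → region′ (terminal′ j) ≡ j
      region′-terminal′ j = trans (cong (π ⟨$⟩ʳ_) (region-terminal _)) (inverseʳ π)

      private
        π⁻¹-fixes-0 : π ⟨$⟩ˡ 0F ≡ 0F
        π⁻¹-fixes-0 = trans (cong (π ⟨$⟩ˡ_) (sym π-fixes-0)) (inverseˡ π)

        from-π : ∀ {i j} → π ⟨$⟩ʳ i ≡ j → i ≡ π ⟨$⟩ˡ j
        from-π e = trans (sym (inverseˡ π)) (cong (π ⟨$⟩ˡ_) e)

        centre : ∀ {i} → π ⟨$⟩ʳ i ≡ 0F → i ≡ 0F
        centre e = trans (from-π e) π⁻¹-fixes-0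

      ReachedEdge-relabel : ∀ j → Bags₄.ReachedEdge region′ terminal′ region′-terminal′ j →
        Bags₄.ReachedEdge region terminal region-terminal (π ⟨$⟩ˡ j)
      ReachedEdge-relabel j (u , v , ru , rv , e , walk) =
        u , v , centre ru , from-π rv , e ,
        subst (λ x → Walk (adj G) _ x u) (cong terminal π⁻¹-fixes-0)
          (walk-weaken (λ x h → Bags.Bag-∋ region terminal region-terminal (centre (≟⇒≡ h))) walk)

    star₄ : (region : Fin n → Fin 4) (terminal : Fin 4 → Fin n) (region-terminal : ∀ j → region (terminal j) ≡ j) →
      MinCut (terminal 1F) (terminal 0F) (⟦ 1F ∷ [] ⟧ ∘ region) →
      MinCut (terminal 2F) (terminal 0F) (⟦ 2F ∷ [] ⟧ ∘ region) →
      MinCut (terminal 3F) (terminal 0F) (⟦ 3F ∷ [] ⟧ ∘ region) → Bags₄.StarBags region terminal region-terminal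
    star₄ region terminal region-terminal B₁-min B₂-min B₃-min = connected , edges
      where
      open Bags region terminal region-terminal
      open Bags₄ region terminal region-terminal
      connected : ∀ j → j ≢ 0F → InducedConnected (adj G) (Bag j)
      connected 0F 0≢0 = ⊥-elim (0≢0 refl)
      connected 1F _ = leafBag-connected 1F B₁-min
      connected 2F _ = leafBag-connected 2F B₂-min
      connected 3F _ = leafBag-connected 3F B₃-min
      edges : ∀ j → j ≢ 0F → ReachedEdge j
      edges 0F 0≢0 = ⊥-elim (0≢0 refl)
      edges 1F _ = star-edge B₂-min B₃-min
      edges 2F _ = ReachedEdge-relabel 1F (star-edge′
          (MinCut-resp B₁-min λ v → masks (region v)) (MinCut-resp B₃-min λ v → masks′ (region v)))
        where
        open Relabel region terminal region-terminal (transpose 1F 2F) refl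
        open Bags₄ region′ terminal′ region′-terminal′ using () renaming (star-edge to star-edge′)
        masks : ∀ i → ⟦ 1F ∷ [] ⟧ i ≡ ⟦ 2F ∷ [] ⟧ (transpose 1F 2F ⟨$⟩ʳ i)
        masks 0F = refl
        masks 1F = refl
        masks 2F = refl
        masks 3F = refl
        masks′ : ∀ i → ⟦ 3F ∷ [] ⟧ i ≡ ⟦ 3F ∷ [] ⟧ (transpose 1F 2F ⟨$⟩ʳ i)
        masks′ 0F = refl
        masks′ 1F = refl
        masks′ 2F = refl
        masks′ 3F = refl
      edges 3F _ = ReachedEdge-relabel 1F (star-edge′
          (MinCut-resp B₂-min λ v → masks (region v)) (MinCut-resp B₁-min λ v → masks′ (region v)))
        where
        open Relabel region terminal region-terminal (transpose 1F 3F) refl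
        open Bags₄ region′ terminal′ region′-terminal′ using () renaming (star-edge to star-edge′)
        masks : ∀ i → ⟦ 2F ∷ [] ⟧ i ≡ ⟦ 2F ∷ [] ⟧ (transpose 1F 3F ⟨$⟩ʳ i)
        masks 0F = refl
        masks 1F = refl
        masks 2F = refl
        masks 3F = refl
        masks′ : ∀ i → ⟦ 1F ∷ [] ⟧ i ≡ ⟦ 3F ∷ [] ⟧ (transpose 1F 3F ⟨$⟩ʳ i)
        masks′ 0F = refl
        masks′ 1F = refl
        masks′ 2F = refl
        masks′ 3F = refl

-- Trees on at most four vertices

pathAdj : ∀ {K} → Fin K → Fin K → Bool
pathAdj a b = (suc (toℕ a) ℕ.≡ᵇ toℕ b) ∨ (suc (toℕ b) ℕ.≡ᵇ toℕ a)

pathAdj-consecutive : ∀ {K} (a b : Fin K) → pathAdj a b ≡ true →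
  suc (toℕ a) ≡ toℕ b ⊎ suc (toℕ b) ≡ toℕ a
pathAdj-consecutive a b h with suc (toℕ a) ℕ.≡ᵇ toℕ b in e
... | true = inj₁ (ℕ.≡ᵇ⇒≡ _ _ (Equivalence.from T-≡ e))
... | false = inj₂ (ℕ.≡ᵇ⇒≡ _ _ (Equivalence.from T-≡ h))

starAdj : Fin 4 → Fin 4 → Bool
starAdj 0F 0F = false
starAdj 0F (suc _) = true
starAdj (suc _) 0F = true
starAdj (suc _) (suc _) = false

starAdj-centre : ∀ a b → starAdj a b ≡ true → (a ≡ 0F × b ≢ 0F) ⊎ (b ≡ 0F × a ≢ 0F)
starAdj-centre 0F (suc b) _ = inj₁ (refl , λ ())
starAdj-centre (suc a) 0F _ = inj₂ (refl , λ ())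

path-edge : ∀ {k} (T : Tree k) → ((π , _) : IsPathTree T) → ∀ i j → toℕ i ℕ.+ 1 ≡ toℕ j →
  adj (tgraph T) (π i) (π j) ≡ true
path-edge T (π , _ , consecutive) i j i+1≡j = Equivalence.from (consecutive i j) (inj₁ i+1≡j)

-- the first and the last edge of a path on four vertices are disjoint
centred-not-path : (T : Tree 4) (c₀ : Fin 4) →
  (∀ x y → adj (tgraph T) x y ≡ true → x ≡ c₀ ⊎ y ≡ c₀) → ¬ IsPathTree T
centred-not-path T c₀ centred p@(π , injective , _) =
  disjoint (centred _ _ (path-edge T p 0F 1F refl)) (centred _ _ (path-edge T p 2F 3F refl))
  where
  disjoint : π 0F ≡ c₀ ⊎ π 1F ≡ c₀ → π 2F ≡ c₀ ⊎ π 3F ≡ c₀ → ⊥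
  disjoint (inj₁ a) (inj₁ b) with () ← injective (trans a (sym b))
  disjoint (inj₁ a) (inj₂ b) with () ← injective (trans a (sym b))
  disjoint (inj₂ a) (inj₁ b) with () ← injective (trans a (sym b))
  disjoint (inj₂ a) (inj₂ b) with () ← injective (trans a (sym b))

symmetrise : ∀ {k} → (Fin k → Fin k → Bool) → Fin k → Fin k → Bool
symmetrise u x y with Fin.<-cmp x y
... | tri< _ _ _ = u x y
... | tri≈ _ _ _ = false
... | tri> _ _ _ = u y x

symmetrise-adj : ∀ {k} (T : Graph k) (u : Fin k → Fin k → Bool) →
  (∀ x y → (toℕ x <ᵇ toℕ y) ≡ true → adj T x y ≡ u x y) → ∀ x y → adj T x y ≡ symmetrise u x y
symmetrise-adj T u upper x y with Fin.<-cmp x y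
... | tri< x<y _ _ = upper x y (Equivalence.to T-≡ (ℕ.<⇒<ᵇ x<y))
... | tri≈ _ refl _ = adj-irr T x
... | tri> _ _ y<x = trans (adj-sym T x y) (upper y x (Equivalence.to T-≡ (ℕ.<⇒<ᵇ y<x)))

inverse : ∀ {m} → (Fin m → Fin m) → Fin m → Fin m
inverse f j with Fin.any? (λ i → f i Fin.≟ j)
... | yes (i , _) = i
... | no _ = j

isBijection? : ∀ {m} (f : Fin m → Fin m) →
  Dec ((∀ j → f (inverse f j) ≡ j) × (∀ i → inverse f (f i) ≡ i))
isBijection? f = Fin.all? (λ j → f (inverse f j) Fin.≟ j) ×-dec Fin.all? (λ i → inverse f (f i) Fin.≟ i)

fromTable : ∀ {m} (f : Vec (Fin m) m) → True (isBijection? (lookup f)) → Permutation m m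
fromTable f bij = permutation (lookup f) (inverse (lookup f)) (proj₁ (toWitness bij)) (proj₂ (toWitness bij))

-- Gomory–Hu trees

module GomoryHu (ℝ : Reals) {n k : ℕ} (G : Graph n) (conn : Connected (adj G)) (z : Fin k → Fin n)
                (c : Fin n → Fin n → Reals.Carrier ℝ) (pos : PositiveCapacity ℝ G c)
                (distinct : DistinctCentralCapacities ℝ G c) (H : GHTree ℝ G c z) where
  open MinimumCuts ℝ G conn c pos
  open Exchange distinct

  tadj : Fin k → Fin k → Bool
  tadj = adj (tgraph (tree H))

  Conclusion : Set
  Conclusion = WeakBagMinor ℝ H × (IsPathTree (tree H) → BagMinor ℝ H)

  -- t is a concrete table equal to the (abstract) adjacency of the tree, so that
  -- properties of the tree can be computed.
  Represents : (Fin k → Fin k → Bool) → Set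
  Represents t = ∀ x y → tadj x y ≡ t x y

  side : (Fin k → Fin k → Bool) → Fin k → Fin k → VSet k
  side t x y = Reachability.reach (removeEdge ℝ t x y) (const true) x

  side-minCut : ∀ t → Represents t → ∀ x y → t x y ≡ true → (M : Fin k → Bool) →
    (∀ i → side t x y i ≡ M i) → MinCut (z x) (z y) (M ∘ bag H)
  side-minCut t rep x y e M side≗M =
    let (A , A⇔ , A-min , _) = gh H x y (trans (rep x y) e) in
    MinCut-resp A-min λ v → ≡-from-true⇔true
      (λ av → trans (sym (side≗M (bag H v)))
        (reach-complete (walk-mapEdges to-t (Equivalence.to (A⇔ v) av)) (reach-source refl)))
      (λ mv → Equivalence.from (A⇔ v)
        (walk-mapEdges from-t (walk-weaken (λ _ _ → refl) (reach-walk (bag H v) (trans (side≗M (bag H v)) mv)))))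
    where
    open Reachability (removeEdge ℝ t x y) (const true) x
    to-t : ∀ u v → removeEdge ℝ tadj x y u v ≡ true → removeEdge ℝ t x y u v ≡ true
    to-t u v = subst (λ b → b ∧ _ ≡ true) (rep u v)
    from-t : ∀ u v → removeEdge ℝ t x y u v ≡ true → removeEdge ℝ tadj x y u v ≡ true
    from-t u v = subst (λ b → b ∧ _ ≡ true) (sym (rep u v))

  disconnected : ∀ t → Represents t → (x j : Fin k) →
    True (Reachability.reach t (const true) x j Bool.≟ false) → ⊥
  disconnected t rep x j unreached = true≢false (trans (sym
      (reach-complete (walk-mapEdges (λ u v h → trans (sym (rep u v)) h) (tconnected (tree H) x j refl refl))
                      (reach-source refl)))
    (toWitness unreached))
    where open Reachability t (const true) x

  cyclic : ∀ t → Represents t → (x : Fin k) (xs : List (Fin k)) →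
    True (2 ℕ.≤? length xs) → True (Unique.unique? Fin._≟_ (x ∷ xs)) →
    True (Linked.linked? (λ u v → t u v Bool.≟ true) ((x ∷ xs) ∷ʳ x)) → ⊥
  cyclic t rep x xs long unique linked = tacyclic (tree H)
    (x , xs , toWitness long , toWitness unique , Linked.map (λ {u} {v} h → trans (rep u v) h) (toWitness linked))

  -- the tree with its vertices relabelled by π, i.e. tree vertex x plays the role π x
  module Labelled (π : Permutation k k) where
    region : Fin n → Fin k
    region = (π ⟨$⟩ʳ_) ∘ bag H

    terminal : Fin k → Fin n
    terminal = z ∘ (π ⟨$⟩ˡ_)

    region-terminal : ∀ j → region (terminal j) ≡ j
    region-terminal j = trans (cong (π ⟨$⟩ʳ_) (bag-z H _)) (inverseʳ π)

    open Bags region terminal region-terminal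

    Shaped : (Fin k → Fin k → Bool) → (Fin k → Fin k → Bool) → Set
    Shaped t shape = True (Fin.all? λ x → Fin.all? λ y → t x y Bool.≟ shape (π ⟨$⟩ʳ x) (π ⟨$⟩ʳ y))

    EdgeSide : (Fin k → Fin k → Bool) → Fin k → Fin k → (Fin k → Bool) → Set
    EdgeSide t a b M = True ((t (π ⟨$⟩ˡ a) (π ⟨$⟩ˡ b) Bool.≟ true) ×-dec
                             Fin.all? λ i → side t (π ⟨$⟩ˡ a) (π ⟨$⟩ˡ b) i Bool.≟ M (π ⟨$⟩ʳ i))

    edge-minCut : ∀ t → Represents t → ∀ a b M → EdgeSide t a b M → MinCut (terminal a) (terminal b) (M ∘ region)
    edge-minCut t rep a b M check =
      let (e , side≗M) = toWitness check in side-minCut t rep (π ⟨$⟩ˡ a) (π ⟨$⟩ˡ b) e (M ∘ (π ⟨$⟩ʳ_)) side≗M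

    π-injective : ∀ {x y} → π ⟨$⟩ʳ x ≡ π ⟨$⟩ʳ y → x ≡ y
    π-injective {x} {y} e = trans (sym (inverseˡ π)) (trans (cong (π ⟨$⟩ˡ_) e) (inverseˡ π))

    treeBag≡Bag : ∀ i v → ⌊ bag H v ≟ i ⌋ ≡ Bag (π ⟨$⟩ʳ i) v
    treeBag≡Bag i v = ≡-from-true⇔true (λ h → Bag-∋ (cong (π ⟨$⟩ʳ_) (≟⇒≡ h)))
                                        (λ h → trans (cong (λ x → ⌊ x ≟ i ⌋) (π-injective (≟⇒≡ h))) (≟-refl i))

    path-conclusion : ∀ t → Represents t → Shaped t pathAdj → PathBags region terminal region-terminal → Conclusion
    path-conclusion t rep shaped (connected , edges) = (const false , (λ _ → refl) , bagMinor) , const bagMinor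
      where
      bagMinor : BagMinor ℝ H
      bagMinor =
        (λ i → InducedConnected-resp (λ v → trans (sym (treeBag≡Bag i v)) (sym (∧-identityʳ _))) (connected (π ⟨$⟩ʳ i))) ,
        λ x y e → let (u , v , ru , rv , uv) = edge-at (π ⟨$⟩ʳ x) (π ⟨$⟩ʳ y)
                        (trans (sym (toWitness shaped x y)) (trans (sym (rep x y)) e))
                  in u , v , π-injective ru , π-injective rv , refl , refl , uv
        where
        edge-at : ∀ a b → pathAdj a b ≡ true → EdgeBetween a b
        edge-at a b adjacent with pathAdj-consecutive a b adjacent
        ... | inj₁ a→b = edges a b a→b
        ... | inj₂ b→a = EdgeBetween-sym (edges b a b→a)

module Classification₂ (ℝ : Reals) {n : ℕ} (G : Graph n) (conn : Connected (adj G)) (z : Fin 2 → Fin n)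
                       (c : Fin n → Fin n → Reals.Carrier ℝ) (pos : PositiveCapacity ℝ G c)
                       (distinct : DistinctCentralCapacities ℝ G c) (H : GHTree ℝ G c z) where
  open MinimumCuts ℝ G conn c pos
  open Exchange distinct
  open GomoryHu ℝ G conn z c pos distinct H

  upper : Bool → Fin 2 → Fin 2 → Bool
  upper b₀₁ 0F 1F = b₀₁
  upper _ _ _ = false

  represents : Represents (symmetrise (upper (tadj 0F 1F)))
  represents = symmetrise-adj (tgraph (tree H)) _ λ { 0F 1F _ → refl }

  path : ∀ t → Represents t → (f : Vec (Fin 2) 2) (bij : True (isBijection? (lookup f))) →
    let open Labelled (fromTable f bij) in
    Shaped t pathAdj → EdgeSide t 0F 1F ⟦ 0F ∷ [] ⟧ → EdgeSide t 1F 0F ⟦ 1F ∷ [] ⟧ → Conclusion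
  path t rep f bij shaped s₀ s₁ = path-conclusion t rep shaped
    (path₂ region terminal region-terminal (edge-minCut t rep 0F 1F ⟦ 0F ∷ [] ⟧ s₀) (edge-minCut t rep 1F 0F ⟦ 1F ∷ [] ⟧ s₁))
    where open Labelled (fromTable f bij)

  classify : ∀ b₀₁ → Represents (symmetrise (upper b₀₁)) → Conclusion
  classify false rep = ⊥-elim (disconnected _ rep 0F 1F tt)
  classify true rep = path _ rep (0F ∷ 1F ∷ []) tt tt tt tt

  conclusion : Conclusion
  conclusion = classify _ represents

module Classification₃ (ℝ : Reals) {n : ℕ} (G : Graph n) (conn : Connected (adj G)) (z : Fin 3 → Fin n)
                       (c : Fin n → Fin n → Reals.Carrier ℝ) (pos : PositiveCapacity ℝ G c)
                       (distinct : DistinctCentralCapacities ℝ G c) (H : GHTree ℝ G c z) where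
  open MinimumCuts ℝ G conn c pos
  open Exchange distinct
  open GomoryHu ℝ G conn z c pos distinct H

  upper : Bool → Bool → Bool → Fin 3 → Fin 3 → Bool
  upper b₀₁ _ _ 0F 1F = b₀₁
  upper _ b₀₂ _ 0F 2F = b₀₂
  upper _ _ b₁₂ 1F 2F = b₁₂
  upper _ _ _ _ _ = false

  represents : Represents (symmetrise (upper (tadj 0F 1F) (tadj 0F 2F) (tadj 1F 2F)))
  represents = symmetrise-adj (tgraph (tree H)) _ λ { 0F 1F _ → refl ; 0F 2F _ → refl ; 1F 2F _ → refl }

  path : ∀ t → Represents t → (f : Vec (Fin 3) 3) (bij : True (isBijection? (lookup f))) →
    let open Labelled (fromTable f bij) in
    Shaped t pathAdj → EdgeSide t 0F 1F ⟦ 0F ∷ [] ⟧ → EdgeSide t 2F 1F ⟦ 2F ∷ [] ⟧ → Conclusion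
  path t rep f bij shaped s₀ s₂ = path-conclusion t rep shaped
    (path₃ region terminal region-terminal
      (edge-minCut t rep 0F 1F ⟦ 0F ∷ [] ⟧ s₀) (edge-minCut t rep 2F 1F ⟦ 2F ∷ [] ⟧ s₂))
    where open Labelled (fromTable f bij)

  classify : ∀ b₀₁ b₀₂ b₁₂ → Represents (symmetrise (upper b₀₁ b₀₂ b₁₂)) → Conclusion
  classify false true true rep = path _ rep (0F ∷ 2F ∷ 1F ∷ []) tt tt tt tt
  classify true false true rep = path _ rep (0F ∷ 1F ∷ 2F ∷ []) tt tt tt tt
  classify true true false rep = path _ rep (1F ∷ 0F ∷ 2F ∷ []) tt tt tt tt
  classify false false _ rep = ⊥-elim (disconnected _ rep 0F 1F tt)
  classify false _ false rep = ⊥-elim (disconnected _ rep 1F 0F tt)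
  classify _ false false rep = ⊥-elim (disconnected _ rep 2F 0F tt)
  classify true true true rep = ⊥-elim (cyclic _ rep 0F (1F ∷ 2F ∷ []) tt tt tt)

  conclusion : Conclusion
  conclusion = classify _ _ _ represents

module Classification₄ (ℝ : Reals) {n : ℕ} (G : Graph n) (conn : Connected (adj G)) (z : Fin 4 → Fin n)
                       (c : Fin n → Fin n → Reals.Carrier ℝ) (pos : PositiveCapacity ℝ G c)
                       (distinct : DistinctCentralCapacities ℝ G c) (H : GHTree ℝ G c z) where
  open MinimumCuts ℝ G conn c pos
  open Exchange distinct
  open GomoryHu ℝ G conn z c pos distinct H

  star-conclusion : ∀ t → Represents t → (π : Permutation 4 4) → Labelled.Shaped π t starAdj →
    (let open Labelled π in Bags₄.StarBags region terminal region-terminal) → Conclusion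
  star-conclusion t rep π shaped (connected , edges) =
      (deleted , kept , connected′ , edges′) ,
      λ is-path → ⊥-elim (centred-not-path (tree H) (π ⟨$⟩ˡ 0F) centred is-path)
    where
    open Labelled π
    open Bags region terminal region-terminal
    open Reachability (adj G) (Bag 0F) (terminal 0F)

    deleted : VSet n
    deleted v = Bag 0F v ∧ not (reach v)

    star-shape : ∀ x y → tadj x y ≡ true → starAdj (π ⟨$⟩ʳ x) (π ⟨$⟩ʳ y) ≡ true
    star-shape x y e = trans (sym (toWitness shaped x y)) (trans (sym (rep x y)) e)

    at-centre : ∀ {x} → π ⟨$⟩ʳ x ≡ 0F → x ≡ π ⟨$⟩ˡ 0F
    at-centre e = trans (sym (inverseˡ π)) (cong (π ⟨$⟩ˡ_) e)

    centred : ∀ x y → tadj x y ≡ true → x ≡ π ⟨$⟩ˡ 0F ⊎ y ≡ π ⟨$⟩ˡ 0F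
    centred x y e with starAdj-centre _ _ (star-shape x y e)
    ... | inj₁ (πx , _) = inj₁ (at-centre πx)
    ... | inj₂ (πy , _) = inj₂ (at-centre πy)

    reached-terminal : reach (terminal 0F) ≡ true
    reached-terminal = reach-source (Bag-∋ (region-terminal 0F))

    kept : ∀ i → deleted (z i) ≡ false
    kept i = ∖-⊆-empty λ h →
      subst (λ x → reach x ≡ true)
            (sym (cong z (at-centre (trans (cong (π ⟨$⟩ʳ_) (sym (bag-z H i))) (≟⇒≡ h)))))
            reached-terminal

    kept-outside : ∀ {v} → region v ≢ 0F → deleted v ≡ false
    kept-outside {v} ne = cong (λ b → b ∧ not (reach v)) (≟-≢ ne)

    connected′ : ∀ i → InducedConnected (adj G) (λ v → ⌊ bag H v ≟ i ⌋ ∧ not (deleted v))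
    connected′ i with π ⟨$⟩ʳ i Fin.≟ 0F
    ... | yes centre = InducedConnected-resp
          (λ v → sym (trans (cong (λ b → b ∧ not (deleted v)) (trans (treeBag≡Bag i v) (cong (λ j → Bag j v) centre)))
                            (∖-∖-⊆ (reach-⊆ v))))
          (InducedConnected-from (terminal 0F) (adj-sym G) reach-walk)
    ... | no leaf = InducedConnected-resp
          (λ v → sym (trans (cong (λ b → b ∧ not (deleted v)) (treeBag≡Bag i v))
                            (∖-disjoint (reach v) λ h → ≟-≢ λ e → leaf (trans (sym (≟⇒≡ h)) e))))
          (connected (π ⟨$⟩ʳ i) leaf)

    from-centre : ∀ x y → π ⟨$⟩ʳ x ≡ 0F → π ⟨$⟩ʳ y ≢ 0F →
      ∃ λ u → ∃ λ v → bag H u ≡ x × bag H v ≡ y × deleted u ≡ false × deleted v ≡ false × adj G u v ≡ true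
    from-centre x y πx πy =
      let (u , v , ru , rv , uv , walk) = edges (π ⟨$⟩ʳ y) πy
      in u , v , π-injective (trans ru (sym πx)) , π-injective rv ,
         ∖-⊆-empty (λ _ → reach-complete walk reached-terminal) , kept-outside (λ e → πy (trans (sym rv) e)) , uv

    edges′ : ∀ x y → tadj x y ≡ true →
      ∃ λ u → ∃ λ v → bag H u ≡ x × bag H v ≡ y × deleted u ≡ false × deleted v ≡ false × adj G u v ≡ true
    edges′ x y e with starAdj-centre _ _ (star-shape x y e)
    ... | inj₁ (πx , πy) = from-centre x y πx πy
    ... | inj₂ (πy , πx) =
      let (u , v , bu , bv , du , dv , uv) = from-centre y x πy πx in v , u , bv , bu , dv , du , trans (adj-sym G v u) uv

  upper : Bool → Bool → Bool → Bool → Bool → Bool → Fin 4 → Fin 4 → Bool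
  upper b₀₁ _ _ _ _ _ 0F 1F = b₀₁
  upper _ b₀₂ _ _ _ _ 0F 2F = b₀₂
  upper _ _ b₀₃ _ _ _ 0F 3F = b₀₃
  upper _ _ _ b₁₂ _ _ 1F 2F = b₁₂
  upper _ _ _ _ b₁₃ _ 1F 3F = b₁₃
  upper _ _ _ _ _ b₂₃ 2F 3F = b₂₃
  upper _ _ _ _ _ _ _ _ = false

  represents : Represents (symmetrise (upper (tadj 0F 1F) (tadj 0F 2F) (tadj 0F 3F) (tadj 1F 2F) (tadj 1F 3F) (tadj 2F 3F)))
  represents = symmetrise-adj (tgraph (tree H)) _ λ
    { 0F 1F _ → refl ; 0F 2F _ → refl ; 0F 3F _ → refl ; 1F 2F _ → refl ; 1F 3F _ → refl ; 2F 3F _ → refl }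

  path : ∀ t → Represents t → (f : Vec (Fin 4) 4) (bij : True (isBijection? (lookup f))) →
    let open Labelled (fromTable f bij) in
    Shaped t pathAdj → EdgeSide t 0F 1F ⟦ 0F ∷ [] ⟧ → EdgeSide t 2F 1F ⟦ 2F ∷ 3F ∷ [] ⟧ →
    EdgeSide t 1F 2F ⟦ 0F ∷ 1F ∷ [] ⟧ → EdgeSide t 3F 2F ⟦ 3F ∷ [] ⟧ → Conclusion
  path t rep f bij shaped s₀ s₂₃ s₀₁ s₃ = path-conclusion t rep shaped
    (path₄ region terminal region-terminal
      (edge-minCut t rep 0F 1F ⟦ 0F ∷ [] ⟧ s₀) (edge-minCut t rep 2F 1F ⟦ 2F ∷ 3F ∷ [] ⟧ s₂₃)
      (edge-minCut t rep 1F 2F ⟦ 0F ∷ 1F ∷ [] ⟧ s₀₁) (edge-minCut t rep 3F 2F ⟦ 3F ∷ [] ⟧ s₃))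
    where open Labelled (fromTable f bij)

  star : ∀ t → Represents t → (f : Vec (Fin 4) 4) (bij : True (isBijection? (lookup f))) →
    let open Labelled (fromTable f bij) in
    Shaped t starAdj → EdgeSide t 1F 0F ⟦ 1F ∷ [] ⟧ → EdgeSide t 2F 0F ⟦ 2F ∷ [] ⟧ →
    EdgeSide t 3F 0F ⟦ 3F ∷ [] ⟧ → Conclusion
  star t rep f bij shaped s₁ s₂ s₃ = star-conclusion t rep (fromTable f bij) shaped
    (star₄ region terminal region-terminal
      (edge-minCut t rep 1F 0F ⟦ 1F ∷ [] ⟧ s₁) (edge-minCut t rep 2F 0F ⟦ 2F ∷ [] ⟧ s₂)
      (edge-minCut t rep 3F 0F ⟦ 3F ∷ [] ⟧ s₃))
    where open Labelled (fromTable f bij)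

  -- The sixteen labelled trees first; every other graph has an isolated vertex,
  -- is a perfect matching, or contains a triangle or a 4-cycle.
  classify : ∀ b₀₁ b₀₂ b₀₃ b₁₂ b₁₃ b₂₃ → Represents (symmetrise (upper b₀₁ b₀₂ b₀₃ b₁₂ b₁₃ b₂₃)) → Conclusion
  classify false false true false true true rep = star _ rep (1F ∷ 2F ∷ 3F ∷ 0F ∷ []) tt tt tt tt tt
  classify false false true true false true rep = path _ rep (0F ∷ 3F ∷ 2F ∷ 1F ∷ []) tt tt tt tt tt tt
  classify false false true true true false rep = path _ rep (0F ∷ 2F ∷ 3F ∷ 1F ∷ []) tt tt tt tt tt tt
  classify false true false false true true rep = path _ rep (0F ∷ 3F ∷ 1F ∷ 2F ∷ []) tt tt tt tt tt tt
  classify false true false true false true rep = star _ rep (1F ∷ 2F ∷ 0F ∷ 3F ∷ []) tt tt tt tt tt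
  classify false true false true true false rep = path _ rep (0F ∷ 2F ∷ 1F ∷ 3F ∷ []) tt tt tt tt tt tt
  classify false true true false true false rep = path _ rep (2F ∷ 0F ∷ 3F ∷ 1F ∷ []) tt tt tt tt tt tt
  classify false true true true false false rep = path _ rep (2F ∷ 0F ∷ 1F ∷ 3F ∷ []) tt tt tt tt tt tt
  classify true false false false true true rep = path _ rep (0F ∷ 1F ∷ 3F ∷ 2F ∷ []) tt tt tt tt tt tt
  classify true false false true false true rep = path _ rep (0F ∷ 1F ∷ 2F ∷ 3F ∷ []) tt tt tt tt tt tt
  classify true false false true true false rep = star _ rep (1F ∷ 0F ∷ 2F ∷ 3F ∷ []) tt tt tt tt tt
  classify true false true false false true rep = path _ rep (1F ∷ 0F ∷ 3F ∷ 2F ∷ []) tt tt tt tt tt tt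
  classify true false true true false false rep = path _ rep (2F ∷ 1F ∷ 0F ∷ 3F ∷ []) tt tt tt tt tt tt
  classify true true false false false true rep = path _ rep (1F ∷ 0F ∷ 2F ∷ 3F ∷ []) tt tt tt tt tt tt
  classify true true false false true false rep = path _ rep (1F ∷ 2F ∷ 0F ∷ 3F ∷ []) tt tt tt tt tt tt
  classify true true true false false false rep = star _ rep (0F ∷ 1F ∷ 2F ∷ 3F ∷ []) tt tt tt tt tt
  classify false false false _ _ _ rep = ⊥-elim (disconnected _ rep 0F 1F tt)
  classify false _ _ false false _ rep = ⊥-elim (disconnected _ rep 1F 0F tt)
  classify _ false _ false _ false rep = ⊥-elim (disconnected _ rep 2F 0F tt)
  classify _ _ false _ false false rep = ⊥-elim (disconnected _ rep 3F 0F tt)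
  classify true false false false false true rep = ⊥-elim (disconnected _ rep 0F 2F tt)
  classify false true false false true false rep = ⊥-elim (disconnected _ rep 0F 1F tt)
  classify false false true true false false rep = ⊥-elim (disconnected _ rep 0F 1F tt)
  classify true true _ true _ _ rep = ⊥-elim (cyclic _ rep 0F (1F ∷ 2F ∷ []) tt tt tt)
  classify true _ true _ true _ rep = ⊥-elim (cyclic _ rep 0F (1F ∷ 3F ∷ []) tt tt tt)
  classify _ true true _ _ true rep = ⊥-elim (cyclic _ rep 0F (2F ∷ 3F ∷ []) tt tt tt)
  classify _ _ _ true true true rep = ⊥-elim (cyclic _ rep 1F (2F ∷ 3F ∷ []) tt tt tt)
  classify true _ true true _ true rep = ⊥-elim (cyclic _ rep 0F (1F ∷ 2F ∷ 3F ∷ []) tt tt tt)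
  classify true true _ _ true true rep = ⊥-elim (cyclic _ rep 0F (1F ∷ 3F ∷ 2F ∷ []) tt tt tt)
  classify _ true true true true _ rep = ⊥-elim (cyclic _ rep 0F (2F ∷ 1F ∷ 3F ∷ []) tt tt tt)

  conclusion : Conclusion
  conclusion = classify _ _ _ _ _ _ represents

module _ (ℝ : Reals) {n : ℕ} {G : Graph n} {c : Fin n → Fin n → Reals.Carrier ℝ} where

  no-terminals : {z : Fin 0 → Fin n} (H : GHTree ℝ G c z) →
    WeakBagMinor ℝ H × (IsPathTree (tree H) → BagMinor ℝ H)
  no-terminals H = (const false , (λ ()) , (λ ()) , (λ ())) , λ _ → (λ ()) , (λ ())

  one-terminal : Connected (adj G) → {z : Fin 1 → Fin n} (H : GHTree ℝ G c z) →
    WeakBagMinor ℝ H × (IsPathTree (tree H) → BagMinor ℝ H)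
  one-terminal conn H = (const false , (λ _ → refl) , bagMinor) , const bagMinor
    where
    whole : ∀ (x : Fin 1) → true ≡ ⌊ x ≟ 0F ⌋ ∧ not false
    whole 0F = refl
    bagMinor : BagMinor ℝ H
    bagMinor = (λ { 0F → InducedConnected-resp (whole ∘ bag H) conn })
             , λ { 0F 0F e → ⊥-elim (true≢false (trans (sym e) (adj-irr (tgraph (tree H)) 0F))) }

proposition7 : (ℝ : Reals) (n k : ℕ) (G : Graph n) → Connected (adj G) →
    (z : Fin k → Fin n) → Injective _≡_ _≡_ z → k ℕ.≤ 4 →
    (c : Fin n → Fin n → Reals.Carrier ℝ) → PositiveCapacity ℝ G c →
    DistinctCentralCapacities ℝ G c →
    (H : GHTree ℝ G c z) →
    WeakBagMinor ℝ H × (IsPathTree (GHTree.tree H) → BagMinor ℝ H)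
proposition7 ℝ n _ G conn z _ z≤n c pos distinct H = no-terminals ℝ H
proposition7 ℝ n _ G conn z _ (s≤s z≤n) c pos distinct H = one-terminal ℝ conn H
proposition7 ℝ n _ G conn z _ (s≤s (s≤s z≤n)) c pos distinct H =
  Classification₂.conclusion ℝ G conn z c pos distinct H
proposition7 ℝ n _ G conn z _ (s≤s (s≤s (s≤s z≤n))) c pos distinct H =
  Classification₃.conclusion ℝ G conn z c pos distinct H
proposition7 ℝ n _ G conn z _ (s≤s (s≤s (s≤s (s≤s z≤n)))) c pos distinct H =
  Classification₄.conclusion ℝ G conn z c pos distinct H
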